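{- Let $\phi:\mathbb{Q}[\alpha_1,\alpha_2]\to\mathbb{Q}$ be a circular integral functional with respect to the circle $C=\{[x,y]\in\mathbb{Q}^2: x^2+y^2=4\}$ (of radius $2$ centered at $[0,0]$). Then for all $m,n\in\mathbb{N}$, \[ \phi(\alpha_1^{2m}\alpha_2^{2n})=2S(m,n),\qquad\text{where } S(m,n)=\frac{(2m)!(2n)!}{m!\,n!\,(m+n)!}. \]
   Context: $\mathbb{N}$ includes $0$. $SO(2,\mathbb{Q})$ is the group of $2\times2$ rational matrices $h$ with $h^{ -1}=h^T$ and $\det h=1$, acting on $\mathbb{Q}[\alpha_1,\alpha_2]$ by $h\cdot\pi(\alpha_1,\alpha_2)=\pi(h_{11}\alpha_1+h_{21}\alpha_2,\,h_{12}\alpha_1+h_{22}\alpha_2)$. A circular integral functional with respect to the circle $C$ of radius $r=2$ centered at $[0,0]$ is a $\mathbb{Q}$-linear map $\phi$ with (Normalization) $\phi(\mathbf{1})=r=2$ for the constant polynomial $\mathbf{1}$; (Locality) $\phi(\pi)=0$ whenever $\pi(x,y)=0$ for all $[x,y]\in C$; (Invariance) $\phi(h\cdot\pi)=\phi(\pi)$ for all $\pi$ and all $h\in SO(2,\mathbb{Q})$. -}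

module Defs where

open import Data.Nat as ℕ using (ℕ; zero; suc)
open import Data.Nat.Properties using (_!≢0; m*n≢0)
open import Data.Nat.Base using (_!)
open import Relation.Nullary using (yes; no)
open import Data.Integer using (+_)
open import Data.Rational using (ℚ; 0ℚ; 1ℚ; _+_; _*_; _-_; _/_)
open import Data.List using (List; []; _∷_; _++_; map; concatMap)
open import Data.Product using (_×_; _,_)
open import Relation.Binary.PropositionalEquality using (_≡_)

-- Polynomials in ℚ[α₁, α₂], represented as formal finite sums of
-- monomials  c · α₁^i · α₂^j  (a term is (c , i , j)).
-- Two representations denote the same polynomial iff all their
-- coefficients agree (_≈ₚ_ below); functionals are required to respect it.

Term : Set
Term = ℚ × ℕ × ℕ

Poly : Set
Poly = List Term

coeff : Poly → ℕ → ℕ → ℚ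
coeff [] i j = 0ℚ
coeff ((c , a , b) ∷ p) i j with a ℕ.≟ i | b ℕ.≟ j
... | yes _ | yes _ = c + coeff p i j
... | _ | _ = coeff p i j

_≈ₚ_ : Poly → Poly → Set
p ≈ₚ q = ∀ i j → coeff p i j ≡ coeff q i j

_⊕_ : Poly → Poly → Poly
p ⊕ q = p ++ q

scale : ℚ → Poly → Poly
scale c p = map (λ { (d , i , j) → (c * d , i , j) }) p

_⊗_ : Poly → Poly → Poly
p ⊗ q = concatMap (λ { (c , i , j) → map (λ { (d , k , l) → (c * d , i ℕ.+ k , j ℕ.+ l) }) q }) p

one : Poly
one = (1ℚ , 0 , 0) ∷ []

_^ₚ_ : Poly → ℕ → Poly
p ^ₚ zero = one
p ^ₚ suc n = p ⊗ (p ^ₚ n)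

mono : ℕ → ℕ → Poly
mono i j = (1ℚ , i , j) ∷ []

powℚ : ℚ → ℕ → ℚ
powℚ x zero = 1ℚ
powℚ x (suc n) = x * powℚ x n

eval : Poly → ℚ → ℚ → ℚ
eval [] x y = 0ℚ
eval ((c , i , j) ∷ p) x y = c * powℚ x i * powℚ y j + eval p x y

record Mat2 : Set where
  constructor mat
  field
    h₁₁ h₁₂ h₂₁ h₂₂ : ℚ

open Mat2 public

record InSO2 (h : Mat2) : Set where
  field
    tl₁₁ : h₁₁ h * h₁₁ h + h₂₁ h * h₂₁ h ≡ 1ℚ
    tl₁₂ : h₁₁ h * h₁₂ h + h₂₁ h * h₂₂ h ≡ 0ℚ
    tl₂₁ : h₁₂ h * h₁₁ h + h₂₂ h * h₂₁ h ≡ 0ℚ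
    tl₂₂ : h₁₂ h * h₁₂ h + h₂₂ h * h₂₂ h ≡ 1ℚ
    tr₁₁ : h₁₁ h * h₁₁ h + h₁₂ h * h₁₂ h ≡ 1ℚ
    tr₁₂ : h₁₁ h * h₂₁ h + h₁₂ h * h₂₂ h ≡ 0ℚ
    tr₂₁ : h₂₁ h * h₁₁ h + h₂₂ h * h₁₂ h ≡ 0ℚ
    tr₂₂ : h₂₁ h * h₂₁ h + h₂₂ h * h₂₂ h ≡ 1ℚ
    det  : h₁₁ h * h₂₂ h - h₁₂ h * h₂₁ h ≡ 1ℚ

act : Mat2 → Poly → Poly
act h p = concatMap (λ { (c , i , j) → scale c ((L₁ ^ₚ i) ⊗ (L₂ ^ₚ j)) }) p
  where
    L₁ L₂ : Poly
    L₁ = (h₁₁ h , 1 , 0) ∷ (h₂₁ h , 0 , 1) ∷ []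
    L₂ = (h₁₂ h , 1 , 0) ∷ (h₂₂ h , 0 , 1) ∷ []

radius : ℚ
radius = + 2 / 1

record CircularIntegralFunctional (φ : Poly → ℚ) : Set where
  field
    respects  : ∀ p q → p ≈ₚ q → φ p ≡ φ q
    additive  : ∀ p q → φ (p ⊕ q) ≡ φ p + φ q
    homog     : ∀ c p → φ (scale c p) ≡ c * φ p
    normalization : φ one ≡ radius
    locality  : ∀ p → (∀ x y → x * x + y * y ≡ radius * radius → eval p x y ≡ 0ℚ) → φ p ≡ 0ℚ
    invariance : ∀ h → InSO2 h → ∀ p → φ (act h p) ≡ φ p

S : ℕ → ℕ → ℚ
S m n = (+ ((2 ℕ.* m) ! ℕ.* (2 ℕ.* n) !)) / (m ! ℕ.* n ! ℕ.* (m ℕ.+ n) !)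
  where
    instance
      _ = m*n≢0 (m ! ℕ.* n !) ((m ℕ.+ n) !) {{m*n≢0 (m !) (n !) {{m !≢0}} {{n !≢0}}}} {{(m ℕ.+ n) !≢0}}

-- Write ψ(m,n) = φ(α₁^m α₂^n) and z = α₁ + iα₂, working over ℚ(i). Invariance under the
-- rotation with cosine 3/5 and sine 4/5 gives φ(z^k) = ω^k φ(z^k) for ω = (3 - 4i)/5, and
-- ω is not a root of unity because (3 - 4i)^k has imaginary part ≡ 1 (mod 5); so
-- φ(z^k) = φ(z̄^k) = 0 for k ≥ 1. Since z z̄ = α₁² + α₂² is 4 on the circle, φ(z^a z̄^b)
-- vanishes whenever a ≠ b. The angular derivation D = α₁∂₂ - α₂∂₁ multiplies z^a z̄^b by
-- i(a - b), hence φ ∘ D = 0, i.e. (n+1) ψ(m+2,n) = (m+1) ψ(m,n+2). With locality,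
-- ψ(m+2,n) + ψ(m,n+2) = 4 ψ(m,n), this gives the recurrences satisfied by 2 S(m,n), and
-- ψ(0,0) = 2 starts them.
module Submission where

open import Defs
open import Data.Nat using (ℕ)
open import Data.Integer using (+_)
open import Data.Rational using (ℚ; _*_; _/_)
open import Relation.Binary.PropositionalEquality using (_≡_)

open import Level using (0ℓ)
open import Function.Base using (_∘_)
open import Data.Empty using (⊥-elim)
open import Data.Nat.Base as ℕ using (zero; suc; _!)
import Data.Nat.Properties as ℕ
import Data.Nat.Divisibility as ℕ
open import Data.Integer.Base as ℤ using (ℤ; +[1+_]; -[1+_])
import Data.Integer.Properties as ℤ
import Data.Integer.Tactic.RingSolver as ℤ-Solver
import Data.Nat.Tactic.RingSolver as ℕ-Solver
open import Data.List.Base using ([]; _∷_; _++_; map)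
open import Data.Product.Base using (_×_; _,_; proj₁; proj₂; ∃₂)
open import Data.Product.Properties using (≡-dec)
open import Data.Rational.Base as ℚ using (mkℚ; 0ℚ; 1ℚ)
import Data.Rational.Properties as ℚ
import Data.Rational.Unnormalised.Base as ℚᵘ
import Data.Rational.Unnormalised.Properties as ℚᵘ
open import Relation.Nullary.Decidable using (yes; no; dec⇒maybe)
open import Relation.Binary.PropositionalEquality
  using (_≢_; refl; sym; trans; cong; cong₂; isEquivalence; module ≡-Reasoning)
open import Algebra.Bundles using (CommutativeRing)
import Tactic.RingSolver.Core.AlmostCommutativeRing as ACR
open import Tactic.RingSolver.Core.Expression using (Κ)
  renaming (_⊕_ to _:+_; _⊗_ to _:*_; ⊝_ to :-_)

ℚ-ring : ACR.AlmostCommutativeRing 0ℓ 0ℓ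
ℚ-ring = ACR.fromCommutativeRing ℚ.+-*-commutativeRing (dec⇒maybe ∘ (0ℚ ℚ.≟_))

import Tactic.RingSolver.NonReflective ℚ-ring as ℚ-Solver

private
  toℚᵘ-/1 : ∀ z → ℚ.toℚᵘ (z / 1) ℚᵘ.≃ ℚᵘ.mkℚᵘ z 0
  toℚᵘ-/1 z = ℚ.toℚᵘ-fromℚᵘ (ℚᵘ.mkℚᵘ z 0)

/1-homo-+ : ∀ a b → (a ℤ.+ b) / 1 ≡ a / 1 ℚ.+ b / 1
/1-homo-+ a b = ℚ.toℚᵘ-injective (begin
  ℚ.toℚᵘ ((a ℤ.+ b) / 1)                   ≈⟨ toℚᵘ-/1 (a ℤ.+ b) ⟩
  ℚᵘ.mkℚᵘ (a ℤ.+ b) 0                      ≈⟨ ℚᵘ.*≡* (identity a b) ⟩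
  ℚᵘ.mkℚᵘ a 0 ℚᵘ.+ ℚᵘ.mkℚᵘ b 0             ≈⟨ ℚᵘ.+-cong (toℚᵘ-/1 a) (toℚᵘ-/1 b) ⟨
  ℚ.toℚᵘ (a / 1) ℚᵘ.+ ℚ.toℚᵘ (b / 1)       ≈⟨ ℚ.toℚᵘ-homo-+ (a / 1) (b / 1) ⟨
  ℚ.toℚᵘ (a / 1 ℚ.+ b / 1)                 ∎)
  where
  open ℚᵘ.≃-Reasoning
  identity : ∀ a b → (a ℤ.+ b) ℤ.* + 1 ≡ (a ℤ.* + 1 ℤ.+ b ℤ.* + 1) ℤ.* + 1
  identity = ℤ-Solver.solve-∀

/1-homo-* : ∀ a b → (a ℤ.* b) / 1 ≡ (a / 1) * (b / 1)
/1-homo-* a b = ℚ.toℚᵘ-injective (begin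
  ℚ.toℚᵘ ((a ℤ.* b) / 1)                   ≈⟨ toℚᵘ-/1 (a ℤ.* b) ⟩
  ℚᵘ.mkℚᵘ a 0 ℚᵘ.* ℚᵘ.mkℚᵘ b 0             ≈⟨ ℚᵘ.*-cong (toℚᵘ-/1 a) (toℚᵘ-/1 b) ⟨
  ℚ.toℚᵘ (a / 1) ℚᵘ.* ℚ.toℚᵘ (b / 1)       ≈⟨ ℚ.toℚᵘ-homo-* (a / 1) (b / 1) ⟨
  ℚ.toℚᵘ ((a / 1) * (b / 1))               ∎)
  where open ℚᵘ.≃-Reasoning

/1-injective : ∀ {a b} → a / 1 ≡ b / 1 → a ≡ b
/1-injective {a} {b} eq with ℚᵘ.≃-trans (ℚᵘ.≃-sym (toℚᵘ-/1 a)) (ℚᵘ.≃-trans (ℚ.toℚᵘ-cong eq) (toℚᵘ-/1 b))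
... | ℚᵘ.*≡* a*1≡b*1 = trans (sym (ℤ.*-identityʳ a)) (trans a*1≡b*1 (ℤ.*-identityʳ b))

[n/d]*[d/1]≡n/1 : ∀ n d → (+ n / suc d) * (+ suc d / 1) ≡ + n / 1
[n/d]*[d/1]≡n/1 n d = ℚ.toℚᵘ-injective (begin
  ℚ.toℚᵘ ((+ n / suc d) * (+ suc d / 1))
    ≈⟨ ℚ.toℚᵘ-homo-* (+ n / suc d) (+ suc d / 1) ⟩
  ℚ.toℚᵘ (+ n / suc d) ℚᵘ.* ℚ.toℚᵘ (+ suc d / 1)
    ≈⟨ ℚᵘ.*-cong (ℚ.toℚᵘ-fromℚᵘ (ℚᵘ.mkℚᵘ (+ n) d)) (toℚᵘ-/1 (+ suc d)) ⟩
  ℚᵘ.mkℚᵘ (+ n) d ℚᵘ.* ℚᵘ.mkℚᵘ (+ suc d) 0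
    ≈⟨ ℚᵘ.*≡* (trans (ℤ.*-identityʳ (+ n ℤ.* + suc d)) (cong (λ k → + n ℤ.* + suc k) (sym (ℕ.*-identityʳ d)))) ⟩
  ℚᵘ.mkℚᵘ (+ n) 0
    ≈⟨ toℚᵘ-/1 (+ n) ⟨
  ℚ.toℚᵘ (+ n / 1)
    ∎)
  where open ℚᵘ.≃-Reasoning

private
  square-nonNeg : ∀ a → ℚ.NonNegative (a * a)
  square-nonNeg a@(mkℚ (+ _) _ _)    = ℚ.nonNeg*nonNeg⇒nonNeg a a
  square-nonNeg a@(mkℚ -[1+ _ ] _ _) = ℚ.nonPos*nonPos⇒nonPos a a

  square-pos : ∀ a → a ≢ 0ℚ → ℚ.Positive (a * a)
  square-pos a@(mkℚ +[1+ _ ] _ _) _ = ℚ.pos*pos⇒pos a a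
  square-pos a@(mkℚ (+ 0) _ _) a≢0  = ⊥-elim (a≢0 (ℚ.↥p≡0⇒p≡0 a refl))
  square-pos a@(mkℚ -[1+ _ ] _ _) _ = ℚ.neg*neg⇒pos a a

  pos⇒≢0 : ∀ p → .{{ℚ.Positive p}} → p ≢ 0ℚ
  pos⇒≢0 (mkℚ +[1+ _ ] _ _) ()

sum-of-squares≢0 : ∀ a b → a ≢ 0ℚ → a * a ℚ.+ b * b ≢ 0ℚ
sum-of-squares≢0 a b a≢0 =
  pos⇒≢0 _ {{ℚ.pos+nonNeg⇒pos (a * a) {{square-pos a a≢0}} (b * b) {{square-nonNeg b}}}}

-- The Gaussian rationals

ℚ[i] : Set
ℚ[i] = ℚ × ℚ

module ℚ[i] where
  open import Algebra.Structures {A = ℚ[i]} _≡_ using (IsCommutativeRing)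
  open import Algebra.Consequences.Propositional using (comm∧distrʳ⇒distrˡ)

  private
    module Components where
      open import Data.Rational.Base using (_+_; _-_)

      assoc-re : ∀ a b c d e f → (a * c - b * d) * e - (a * d + b * c) * f ≡ a * (c * e - d * f) - b * (c * f + d * e)
      assoc-re = ℚ-Solver.solve 6 (λ a b c d e f →
        (a :* c :+ :- (b :* d)) :* e :+ :- ((a :* d :+ b :* c) :* f)
        ℚ-Solver.⊜ (a :* (c :* e :+ :- (d :* f)) :+ :- (b :* (c :* f :+ d :* e)))) refl

      assoc-im : ∀ a b c d e f → (a * c - b * d) * f + (a * d + b * c) * e ≡ a * (c * f + d * e) + b * (c * e - d * f)
      assoc-im = ℚ-Solver.solve 6 (λ a b c d e f →
        (a :* c :+ :- (b :* d)) :* f :+ (a :* d :+ b :* c) :* e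
        ℚ-Solver.⊜ (a :* (c :* f :+ d :* e) :+ b :* (c :* e :+ :- (d :* f)))) refl

      identityˡ-re : ∀ a b → 1ℚ * a - 0ℚ * b ≡ a
      identityˡ-re = ℚ-Solver.solve 2 (λ a b → Κ 1ℚ :* a :+ :- (Κ 0ℚ :* b) ℚ-Solver.⊜ a) refl

      identityˡ-im : ∀ a b → 1ℚ * b + 0ℚ * a ≡ b
      identityˡ-im = ℚ-Solver.solve 2 (λ a b → Κ 1ℚ :* b :+ Κ 0ℚ :* a ℚ-Solver.⊜ b) refl

      distribʳ-re : ∀ a b c d e f → (c + e) * a - (d + f) * b ≡ (c * a - d * b) + (e * a - f * b)
      distribʳ-re = ℚ-Solver.solve 6 (λ a b c d e f →
        (c :+ e) :* a :+ :- ((d :+ f) :* b)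
        ℚ-Solver.⊜ (c :* a :+ :- (d :* b) :+ (e :* a :+ :- (f :* b)))) refl

      distribʳ-im : ∀ a b c d e f → (c + e) * b + (d + f) * a ≡ (c * b + d * a) + (e * b + f * a)
      distribʳ-im = ℚ-Solver.solve 6 (λ a b c d e f →
        (c :+ e) :* b :+ (d :+ f) :* a
        ℚ-Solver.⊜ (c :* b :+ d :* a :+ (e :* b :+ f :* a))) refl

      comm-re : ∀ a b c d → a * c - b * d ≡ c * a - d * b
      comm-re = ℚ-Solver.solve 4 (λ a b c d → a :* c :+ :- (b :* d) ℚ-Solver.⊜ (c :* a :+ :- (d :* b))) refl

      comm-im : ∀ a b c d → a * d + b * c ≡ c * b + d * a
      comm-im = ℚ-Solver.solve 4 (λ a b c d → a :* d :+ b :* c ℚ-Solver.⊜ (c :* b :+ d :* a)) refl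

  infixl 7 _·_
  infixl 6 _+_ _-_
  infix  8 -_

  _+_ _·_ : ℚ[i] → ℚ[i] → ℚ[i]
  (a , b) + (c , d) = (a ℚ.+ c , b ℚ.+ d)
  (a , b) · (c , d) = (a * c ℚ.- b * d , a * d ℚ.+ b * c)

  -_ : ℚ[i] → ℚ[i]
  - (a , b) = (ℚ.- a , ℚ.- b)

  _-_ : ℚ[i] → ℚ[i] → ℚ[i]
  x - y = x + - y

  0ᵢ 1ᵢ i : ℚ[i]
  0ᵢ = (0ℚ , 0ℚ)
  1ᵢ = (1ℚ , 0ℚ)
  i  = (0ℚ , 1ℚ)

  private
    open Components

    ·-comm′ : ∀ x y → x · y ≡ y · x
    ·-comm′ (a , b) (c , d) = cong₂ _,_ (comm-re a b c d) (comm-im a b c d)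

    ·-distribʳ′ : ∀ x y z → (y + z) · x ≡ y · x + z · x
    ·-distribʳ′ (a , b) (c , d) (e , f) = cong₂ _,_ (distribʳ-re a b c d e f) (distribʳ-im a b c d e f)

    ·-identityˡ′ : ∀ x → 1ᵢ · x ≡ x
    ·-identityˡ′ (a , b) = cong₂ _,_ (identityˡ-re a b) (identityˡ-im a b)

  +-·-isCommutativeRing : IsCommutativeRing _+_ _·_ -_ 0ᵢ 1ᵢ
  +-·-isCommutativeRing = record
    { isRing = record
      { +-isAbelianGroup = record
        { isGroup = record
          { isMonoid = record
            { isSemigroup = record
              { isMagma = record { isEquivalence = isEquivalence ; ∙-cong = cong₂ _+_ }
              ; assoc = λ (a , b) (c , d) (e , f) → cong₂ _,_ (ℚ.+-assoc a c e) (ℚ.+-assoc b d f)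
              }
            ; identity = (λ (a , b) → cong₂ _,_ (ℚ.+-identityˡ a) (ℚ.+-identityˡ b))
                       , (λ (a , b) → cong₂ _,_ (ℚ.+-identityʳ a) (ℚ.+-identityʳ b))
            }
          ; inverse = (λ (a , b) → cong₂ _,_ (ℚ.+-inverseˡ a) (ℚ.+-inverseˡ b))
                    , (λ (a , b) → cong₂ _,_ (ℚ.+-inverseʳ a) (ℚ.+-inverseʳ b))
          ; ⁻¹-cong = cong (-_)
          }
        ; comm = λ (a , b) (c , d) → cong₂ _,_ (ℚ.+-comm a c) (ℚ.+-comm b d)
        }
      ; *-cong = cong₂ _·_
      ; *-assoc = λ (a , b) (c , d) (e , f) → cong₂ _,_ (assoc-re a b c d e f) (assoc-im a b c d e f)
      ; *-identity = ·-identityˡ′ , λ x → trans (·-comm′ x 1ᵢ) (·-identityˡ′ x)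
      ; distrib = comm∧distrʳ⇒distrˡ ·-comm′ ·-distribʳ′ , ·-distribʳ′
      }
    ; *-comm = ·-comm′
    }

  +-·-commutativeRing : CommutativeRing 0ℓ 0ℓ
  +-·-commutativeRing = record { isCommutativeRing = +-·-isCommutativeRing }

  open CommutativeRing +-·-commutativeRing public
    using (+-identityˡ; +-identityʳ; +-assoc; +-comm; -‿inverseʳ; semiring; commutativeSemiring)
    renaming (*-identityˡ to ·-identityˡ; *-identityʳ to ·-identityʳ; *-assoc to ·-assoc;
              *-comm to ·-comm; zeroˡ to ·-zeroˡ; zeroʳ to ·-zeroʳ)

ℚ[i]-ring : ACR.AlmostCommutativeRing 0ℓ 0ℓ
ℚ[i]-ring = ACR.fromCommutativeRing ℚ[i].+-·-commutativeRing (dec⇒maybe ∘ (≡-dec ℚ._≟_ ℚ._≟_ ℚ[i].0ᵢ))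

open import Tactic.RingSolver.NonReflective ℚ[i]-ring using (solve; _⊜_)
open ℚ[i]
import Algebra.Properties.Semiring.Mult semiring as Mult
open import Algebra.Properties.CommutativeSemiring.Exp commutativeSemiring using (_^_; ^-distrib-*)

↑_ : ℚ → ℚ[i]
↑ a = (a , 0ℚ)

↑-homo-* : ∀ a b → ↑ (a * b) ≡ ↑ a · ↑ b
↑-homo-* a b = cong₂ _,_ (re a b) (im a b)
  where
  re : ∀ a b → a * b ≡ a * b ℚ.- 0ℚ * 0ℚ
  re = ℚ-Solver.solve 2 (λ a b → a :* b ℚ-Solver.⊜ (a :* b :+ :- (Κ 0ℚ :* Κ 0ℚ))) refl
  im : ∀ a b → 0ℚ ≡ a * 0ℚ ℚ.+ 0ℚ * b
  im = ℚ-Solver.solve 2 (λ a b → Κ 0ℚ ℚ-Solver.⊜ (a :* Κ 0ℚ :+ Κ 0ℚ :* b)) refl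

x·y≡0⇒y≡0 : ∀ {x y} → x ≢ 0ᵢ → x · y ≡ 0ᵢ → y ≡ 0ᵢ
x·y≡0⇒y≡0 {x@(a , b)} {y} x≢0 xy≡0 = begin
  y                             ≡⟨ ·-identityˡ y ⟨
  1ᵢ · y                        ≡⟨ cong (_· y) inverse ⟨
  (↑ (ℚ.1/ N) · (x̄ · x)) · y    ≡⟨ reassociate (↑ (ℚ.1/ N)) x̄ x y ⟩
  ↑ (ℚ.1/ N) · x̄ · (x · y)      ≡⟨ cong (↑ (ℚ.1/ N) · x̄ ·_) xy≡0 ⟩
  ↑ (ℚ.1/ N) · x̄ · 0ᵢ           ≡⟨ ·-zeroʳ (↑ (ℚ.1/ N) · x̄) ⟩
  0ᵢ                            ∎
  where
  open ≡-Reasoning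
  N = a * a ℚ.+ b * b
  x̄ = (a , ℚ.- b)
  N≢0 : N ≢ 0ℚ
  N≢0 with a ℚ.≟ 0ℚ | b ℚ.≟ 0ℚ
  ... | yes refl | yes refl = ⊥-elim (x≢0 refl)
  ... | yes refl | no b≢0   = λ N≡0 → sum-of-squares≢0 b a b≢0 (trans (ℚ.+-comm (b * b) (0ℚ * 0ℚ)) N≡0)
  ... | no a≢0   | _        = sum-of-squares≢0 a b a≢0
  instance _ = ℚ.≢-nonZero N≢0
  norm : x̄ · x ≡ ↑ N
  norm = cong₂ _,_ (re a b) (im a b)
    where
    re : ∀ a b → a * a ℚ.- ℚ.- b * b ≡ a * a ℚ.+ b * b
    re = ℚ-Solver.solve 2 (λ a b → a :* a :+ :- (:- b :* b) ℚ-Solver.⊜ (a :* a :+ b :* b)) refl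
    im : ∀ a b → a * b ℚ.+ ℚ.- b * a ≡ 0ℚ
    im = ℚ-Solver.solve 2 (λ a b → a :* b :+ :- b :* a ℚ-Solver.⊜ Κ 0ℚ) refl
  inverse : ↑ (ℚ.1/ N) · (x̄ · x) ≡ 1ᵢ
  inverse = trans (cong (↑ (ℚ.1/ N) ·_) norm) (trans (sym (↑-homo-* (ℚ.1/ N) N)) (cong ↑_ (ℚ.*-inverseˡ N)))
  reassociate : ∀ u v w z → (u · (v · w)) · z ≡ u · v · (w · z)
  reassociate = solve 4 (λ u v w z → u :* (v :* w) :* z ⊜ u :* v :* (w :* z)) refl

·-cancelˡ : ∀ {x y z} → x ≢ 0ᵢ → x · y ≡ x · z → y ≡ z
·-cancelˡ {x} {y} {z} x≢0 xy≡xz = begin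
  y                    ≡⟨ split y z ⟩
  (y - z) + z          ≡⟨ cong (λ t → t + z) (x·y≡0⇒y≡0 x≢0 x[y-z]≡0) ⟩
  0ᵢ + z               ≡⟨ +-identityˡ z ⟩
  z                    ∎
  where
  open ≡-Reasoning
  split : ∀ y z → y ≡ (y - z) + z
  split = solve 2 (λ y z → y ⊜ (y :+ :- z :+ z)) refl
  expand : ∀ x y z → x · (y - z) ≡ x · y - x · z
  expand = solve 3 (λ x y z → x :* (y :+ :- z) ⊜ (x :* y :+ :- (x :* z))) refl
  x[y-z]≡0 : x · (y - z) ≡ 0ᵢ
  x[y-z]≡0 = trans (expand x y z) (trans (cong (λ t → x · y - t) (sym xy≡xz)) (-‿inverseʳ (x · y)))

·-cancelʳ : ∀ {x y z} → z ≢ 0ᵢ → x · z ≡ y · z → x ≡ y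
·-cancelʳ {x} {y} {z} z≢0 xz≡yz = ·-cancelˡ z≢0 (trans (·-comm z x) (trans xz≡yz (·-comm y z)))

v≡w·v⇒v≡0 : ∀ {w v} → w ≢ 1ᵢ → v ≡ w · v → v ≡ 0ᵢ
v≡w·v⇒v≡0 {w} {v} w≢1 v≡wv = ·-cancelˡ 1-w≢0 (begin
  (1ᵢ - w) · v      ≡⟨ expand w v ⟩
  v - w · v         ≡⟨ cong (λ t → v - t) v≡wv ⟨
  v - v             ≡⟨ -‿inverseʳ v ⟩
  0ᵢ                ≡⟨ ·-zeroʳ (1ᵢ - w) ⟨
  (1ᵢ - w) · 0ᵢ     ∎)
  where
  open ≡-Reasoning
  expand : ∀ w v → (1ᵢ - w) · v ≡ v - w · v
  expand = solve 2 (λ w v → (Κ 1ᵢ :+ :- w) :* v ⊜ (v :+ :- (w :* v))) refl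
  1-w≢0 : 1ᵢ - w ≢ 0ᵢ
  1-w≢0 1-w≡0 = w≢1 (begin
    w                 ≡⟨ double-negation w ⟩
    1ᵢ - (1ᵢ - w)     ≡⟨ cong (λ t → 1ᵢ - t) 1-w≡0 ⟩
    1ᵢ - 0ᵢ           ≡⟨⟩
    1ᵢ                ∎)
    where
    double-negation : ∀ w → w ≡ 1ᵢ - (1ᵢ - w)
    double-negation = solve 1 (λ w → w ⊜ (Κ 1ᵢ :+ :- (Κ 1ᵢ :+ :- w))) refl

e²+1≡0 : ∀ e → e · e ≡ - 1ᵢ → ∀ x → (e · e + 1ᵢ) · x ≡ 0ᵢ
e²+1≡0 e e²≡-1 x = trans (cong (λ t → (t + 1ᵢ) · x) e²≡-1) (cancel x)
  where
  cancel : ∀ x → (- 1ᵢ + 1ᵢ) · x ≡ 0ᵢ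
  cancel = solve 1 (λ x → (:- Κ 1ᵢ :+ Κ 1ᵢ) :* x ⊜ Κ 0ᵢ) refl

1ᵢ^n≡1ᵢ : ∀ n → 1ᵢ ^ n ≡ 1ᵢ
1ᵢ^n≡1ᵢ zero    = refl
1ᵢ^n≡1ᵢ (suc n) = trans (·-identityˡ (1ᵢ ^ n)) (1ᵢ^n≡1ᵢ n)

ι : ℕ → ℚ[i]
ι n = n Mult.× 1ᵢ

ι-homo-+ : ∀ m n → ι (m ℕ.+ n) ≡ ι m + ι n
ι-homo-+ = Mult.×-homo-+ 1ᵢ

ι-homo-* : ∀ m n → ι (m ℕ.* n) ≡ ι m · ι n
ι-homo-* = Mult.×1-homo-*

ι-homo-*₃ : ∀ a b c → ι (a ℕ.* b ℕ.* c) ≡ ι a · ι b · ι c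
ι-homo-*₃ a b c = trans (ι-homo-* (a ℕ.* b) c) (cong (_· ι c) (ι-homo-* a b))

ι-homo-^ : ∀ m n → ι m ^ n ≡ ι (m ℕ.^ n)
ι-homo-^ m zero    = refl
ι-homo-^ m (suc n) = trans (cong (ι m ·_) (ι-homo-^ m n)) (sym (ι-homo-* m (m ℕ.^ n)))

ι≡↑n/1 : ∀ n → ι n ≡ ↑ (+ n / 1)
ι≡↑n/1 zero    = refl
ι≡↑n/1 (suc n) = trans (cong₂ _+_ (refl {x = 1ᵢ}) (ι≡↑n/1 n)) (cong ↑_ (sym (/1-homo-+ (+ 1) (+ n))))

ι-suc≢0 : ∀ n → ι (suc n) ≢ 0ᵢ
ι-suc≢0 n eq with /1-injective {+ suc n} {+ 0} (cong proj₁ (trans (sym (ι≡↑n/1 (suc n))) eq))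
... | ()

ι≢0 : ∀ d .{{_ : ℕ.NonZero d}} → ι d ≢ 0ᵢ
ι≢0 (suc d) = ι-suc≢0 d

↑n/d·ι≡ι : ∀ n d .{{_ : ℕ.NonZero d}} → ↑ (+ n / d) · ι d ≡ ι n
↑n/d·ι≡ι n (suc d) = begin
  ↑ (+ n / suc d) · ι (suc d)              ≡⟨ cong (↑ (+ n / suc d) ·_) (ι≡↑n/1 (suc d)) ⟩
  ↑ (+ n / suc d) · ↑ (+ suc d / 1)        ≡⟨ ↑-homo-* (+ n / suc d) (+ suc d / 1) ⟨
  ↑ ((+ n / suc d) * (+ suc d / 1))        ≡⟨ cong ↑_ ([n/d]*[d/1]≡n/1 n d) ⟩
  ↑ (+ n / 1)                              ≡⟨ ι≡↑n/1 n ⟨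
  ι n                                      ∎
  where open ≡-Reasoning

-- Tables of moments

-- A table F stands for the ℚ(i)-linear functional p ↦ F ⟦ p ⟧ with values F m n on the
-- monomials α₁^m α₂^n; mulLin a b F is the table of p ↦ F ⟦ (a α₁ + b α₂) p ⟧.
Table : Set
Table = ℕ → ℕ → ℚ[i]

infix 4 _≗₂_
_≗₂_ : Table → Table → Set
F ≗₂ G = ∀ m n → F m n ≡ G m n

shift : ℕ → ℕ → Table → Table
shift m n F k l = F (m ℕ.+ k) (n ℕ.+ l)

mulLin : ℚ[i] → ℚ[i] → Table → Table
mulLin a b F m n = a · F (suc m) n + b · F m (suc n)

iterate : (Table → Table) → ℕ → Table → Table
iterate T zero    F = F
iterate T (suc k) F = iterate T k (T F)

infix 9 _⟦_⟧
_⟦_⟧ : Table → Poly → ℚ[i]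
F ⟦ [] ⟧              = 0ᵢ
F ⟦ (c , m , n) ∷ p ⟧ = ↑ c · F m n + F ⟦ p ⟧

linear : ℚ → ℚ → Poly
linear a b = (a , 1 , 0) ∷ (b , 0 , 1) ∷ []

⟦⟧-cong : ∀ {F G} → F ≗₂ G → ∀ p → F ⟦ p ⟧ ≡ G ⟦ p ⟧
⟦⟧-cong F≗G []                = refl
⟦⟧-cong F≗G ((c , m , n) ∷ p) = cong₂ (λ x y → ↑ c · x + y) (F≗G m n) (⟦⟧-cong F≗G p)

⟦⟧-++ : ∀ F p q → F ⟦ p ++ q ⟧ ≡ F ⟦ p ⟧ + F ⟦ q ⟧
⟦⟧-++ F []                q = sym (+-identityˡ (F ⟦ q ⟧))
⟦⟧-++ F ((c , m , n) ∷ p) q =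
  trans (cong (λ t → ↑ c · F m n + t) (⟦⟧-++ F p q)) (sym (+-assoc (↑ c · F m n) (F ⟦ p ⟧) (F ⟦ q ⟧)))

⟦⟧-linearCombination : ∀ x F y G p →
  (λ m n → x · F m n + y · G m n) ⟦ p ⟧ ≡ x · F ⟦ p ⟧ + y · G ⟦ p ⟧
⟦⟧-linearCombination x F y G []                = distribute x y
  where
  distribute : ∀ x y → 0ᵢ ≡ x · 0ᵢ + y · 0ᵢ
  distribute = solve 2 (λ x y → Κ 0ᵢ ⊜ (x :* Κ 0ᵢ :+ y :* Κ 0ᵢ)) refl
⟦⟧-linearCombination x F y G ((c , m , n) ∷ p) =
  trans (cong (λ t → ↑ c · (x · F m n + y · G m n) + t) (⟦⟧-linearCombination x F y G p))
        (distribute x y (↑ c) (F m n) (G m n) (F ⟦ p ⟧) (G ⟦ p ⟧))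
  where
  distribute : ∀ x y c u v U V → c · (x · u + y · v) + (x · U + y · V) ≡ x · (c · u + U) + y · (c · v + V)
  distribute = solve 7 (λ x y c u v U V →
    c :* (x :* u :+ y :* v) :+ (x :* U :+ y :* V)
    ⊜ (x :* (c :* u :+ U) :+ y :* (c :* v :+ V))) refl

-- Stated for any f acting like the pattern lambdas inside scale and _⊗_, which cannot be named.
⟦⟧-map : ∀ F c m n (f : Term → Term) → (∀ d k l → f (d , k , l) ≡ (c ℚ.* d , m ℕ.+ k , n ℕ.+ l)) →
         ∀ q → F ⟦ map f q ⟧ ≡ ↑ c · shift m n F ⟦ q ⟧
⟦⟧-map F c m n f f-def []                = sym (·-zeroʳ (↑ c))
⟦⟧-map F c m n f f-def ((d , k , l) ∷ q) rewrite f-def d k l =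
  trans (cong₂ (λ x y → x · F (m ℕ.+ k) (n ℕ.+ l) + y) (↑-homo-* c d) (⟦⟧-map F c m n f f-def q))
        (distribute (↑ c) (↑ d) (F (m ℕ.+ k) (n ℕ.+ l)) (shift m n F ⟦ q ⟧))
  where
  distribute : ∀ c d x y → c · d · x + c · y ≡ c · (d · x + y)
  distribute = solve 4 (λ c d x y → c :* d :* x :+ c :* y ⊜ c :* (d :* x :+ y)) refl

⟦⟧-scale : ∀ F c p → F ⟦ scale c p ⟧ ≡ ↑ c · F ⟦ p ⟧
⟦⟧-scale F c = ⟦⟧-map F c 0 0 _ (λ _ _ _ → refl)

⟦⟧-⊗ : ∀ F p q → F ⟦ p ⊗ q ⟧ ≡ (λ m n → shift m n F ⟦ q ⟧) ⟦ p ⟧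
⟦⟧-⊗ F []                q = refl
⟦⟧-⊗ F ((c , m , n) ∷ p) q =
  trans (⟦⟧-++ F (map _ q) (p ⊗ q)) (cong₂ _+_ (⟦⟧-map F c m n _ (λ _ _ _ → refl) q) (⟦⟧-⊗ F p q))

⟦⟧-⊗-assoc : ∀ F p q r → F ⟦ (p ⊗ q) ⊗ r ⟧ ≡ F ⟦ p ⊗ (q ⊗ r) ⟧
⟦⟧-⊗-assoc F p q r = begin
  F ⟦ (p ⊗ q) ⊗ r ⟧                                           ≡⟨ ⟦⟧-⊗ F (p ⊗ q) r ⟩
  (λ m n → shift m n F ⟦ r ⟧) ⟦ p ⊗ q ⟧                       ≡⟨ ⟦⟧-⊗ _ p q ⟩
  (λ m n → (λ k l → shift (m ℕ.+ k) (n ℕ.+ l) F ⟦ r ⟧) ⟦ q ⟧) ⟦ p ⟧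
    ≡⟨ ⟦⟧-cong (λ m n → ⟦⟧-cong (λ k l → ⟦⟧-cong (λ s t → cong₂ F (ℕ.+-assoc m k s) (ℕ.+-assoc n l t)) r) q) p ⟩
  (λ m n → (λ k l → shift k l (shift m n F) ⟦ r ⟧) ⟦ q ⟧) ⟦ p ⟧ ≡⟨ ⟦⟧-cong (λ m n → ⟦⟧-⊗ (shift m n F) q r) p ⟨
  (λ m n → shift m n F ⟦ q ⊗ r ⟧) ⟦ p ⟧                       ≡⟨ ⟦⟧-⊗ F p (q ⊗ r) ⟨
  F ⟦ p ⊗ (q ⊗ r) ⟧                                           ∎
  where
  open ≡-Reasoning

⟦⟧-one⊗ : ∀ F q → F ⟦ one ⊗ q ⟧ ≡ F ⟦ q ⟧
⟦⟧-one⊗ F q = begin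
  F ⟦ one ⊗ q ⟧              ≡⟨ ⟦⟧-⊗ F one q ⟩
  1ᵢ · F ⟦ q ⟧ + 0ᵢ          ≡⟨ +-identityʳ _ ⟩
  1ᵢ · F ⟦ q ⟧               ≡⟨ ·-identityˡ _ ⟩
  F ⟦ q ⟧                    ∎
  where open ≡-Reasoning

⟦⟧-linear⊗ : ∀ F a b q → F ⟦ linear a b ⊗ q ⟧ ≡ mulLin (↑ a) (↑ b) F ⟦ q ⟧
⟦⟧-linear⊗ F a b q = begin
  F ⟦ linear a b ⊗ q ⟧                                     ≡⟨ ⟦⟧-⊗ F (linear a b) q ⟩
  ↑ a · shift 1 0 F ⟦ q ⟧ + (↑ b · shift 0 1 F ⟦ q ⟧ + 0ᵢ) ≡⟨ cong (λ t → ↑ a · shift 1 0 F ⟦ q ⟧ + t) (+-identityʳ _) ⟩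
  ↑ a · shift 1 0 F ⟦ q ⟧ + ↑ b · shift 0 1 F ⟦ q ⟧
    ≡⟨ ⟦⟧-linearCombination (↑ a) (shift 1 0 F) (↑ b) (shift 0 1 F) q ⟨
  mulLin (↑ a) (↑ b) F ⟦ q ⟧                               ∎
  where open ≡-Reasoning

⟦⟧-linear^⊗ : ∀ F a b k q → F ⟦ (linear a b ^ₚ k) ⊗ q ⟧ ≡ iterate (mulLin (↑ a) (↑ b)) k F ⟦ q ⟧
⟦⟧-linear^⊗ F a b zero    q = ⟦⟧-one⊗ F q
⟦⟧-linear^⊗ F a b (suc k) q = begin
  F ⟦ (linear a b ⊗ (linear a b ^ₚ k)) ⊗ q ⟧   ≡⟨ ⟦⟧-⊗-assoc F (linear a b) (linear a b ^ₚ k) q ⟩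
  F ⟦ linear a b ⊗ ((linear a b ^ₚ k) ⊗ q) ⟧   ≡⟨ ⟦⟧-linear⊗ F a b _ ⟩
  mulLin (↑ a) (↑ b) F ⟦ (linear a b ^ₚ k) ⊗ q ⟧ ≡⟨ ⟦⟧-linear^⊗ (mulLin (↑ a) (↑ b) F) a b k q ⟩
  iterate (mulLin (↑ a) (↑ b)) (suc k) F ⟦ q ⟧ ∎
  where open ≡-Reasoning

⟦⟧-linear^ : ∀ F a b k → F ⟦ linear a b ^ₚ k ⟧ ≡ iterate (mulLin (↑ a) (↑ b)) k F 0 0
⟦⟧-linear^ F a b zero    = trans (+-identityʳ _) (·-identityˡ (F 0 0))
⟦⟧-linear^ F a b (suc k) = trans (⟦⟧-linear⊗ F a b _) (⟦⟧-linear^ (mulLin (↑ a) (↑ b) F) a b k)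

transform : Mat2 → Table → Table
transform h F m n =
  iterate (mulLin (↑ h₁₂ h) (↑ h₂₂ h)) n (iterate (mulLin (↑ h₁₁ h) (↑ h₂₁ h)) m F) 0 0

⟦⟧-act-mono : ∀ F h m n → F ⟦ act h (mono m n) ⟧ ≡ transform h F m n
⟦⟧-act-mono F h m n = begin
  F ⟦ scale 1ℚ ((L₁ ^ₚ m) ⊗ (L₂ ^ₚ n)) ++ [] ⟧       ≡⟨ trans (⟦⟧-++ F _ []) (+-identityʳ _) ⟩
  F ⟦ scale 1ℚ ((L₁ ^ₚ m) ⊗ (L₂ ^ₚ n)) ⟧             ≡⟨ trans (⟦⟧-scale F 1ℚ _) (·-identityˡ _) ⟩
  F ⟦ (L₁ ^ₚ m) ⊗ (L₂ ^ₚ n) ⟧                     ≡⟨ ⟦⟧-linear^⊗ F (h₁₁ h) (h₂₁ h) m _ ⟩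
  iterate (mulLin (↑ h₁₁ h) (↑ h₂₁ h)) m F ⟦ L₂ ^ₚ n ⟧ ≡⟨ ⟦⟧-linear^ _ (h₁₂ h) (h₂₂ h) n ⟩
  transform h F m n                              ∎
  where
  open ≡-Reasoning
  L₁ = linear (h₁₁ h) (h₂₁ h)
  L₂ = linear (h₁₂ h) (h₂₂ h)

Circular : Table → Set
Circular F = ∀ m n → F (suc (suc m)) n + F m (suc (suc n)) ≡ ι 4 · F m n

infixl 6 _+ₜ_
infixl 7 _·ₜ_

_+ₜ_ : Table → Table → Table
(F +ₜ G) m n = F m n + G m n

_·ₜ_ : ℚ[i] → Table → Table
(c ·ₜ F) m n = c · F m n

module _ (a b : ℚ[i]) where

  mulLin-cong : ∀ {F G} → F ≗₂ G → mulLin a b F ≗₂ mulLin a b G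
  mulLin-cong F≗G m n = cong₂ (λ x y → a · x + b · y) (F≗G (suc m) n) (F≗G m (suc n))

  mulLin-+ : ∀ F G → mulLin a b (F +ₜ G) ≗₂ mulLin a b F +ₜ mulLin a b G
  mulLin-+ F G m n = distribute a b (F (suc m) n) (G (suc m) n) (F m (suc n)) (G m (suc n))
    where
    distribute : ∀ a b x y u v → a · (x + y) + b · (u + v) ≡ (a · x + b · u) + (a · y + b · v)
    distribute = solve 6 (λ a b x y u v →
      a :* (x :+ y) :+ b :* (u :+ v)
      ⊜ (a :* x :+ b :* u :+ (a :* y :+ b :* v))) refl

  mulLin-· : ∀ c F → mulLin a b (c ·ₜ F) ≗₂ c ·ₜ mulLin a b F
  mulLin-· c F m n = distribute a b c (F (suc m) n) (F m (suc n))
    where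
    distribute : ∀ a b c x y → a · (c · x) + b · (c · y) ≡ c · (a · x + b · y)
    distribute = solve 5 (λ a b c x y →
      a :* (c :* x) :+ b :* (c :* y)
      ⊜ c :* (a :* x :+ b :* y)) refl

  mulLin-comm : ∀ c d F → mulLin a b (mulLin c d F) ≗₂ mulLin c d (mulLin a b F)
  mulLin-comm c d F m n = commute a b c d (F (suc (suc m)) n) (F (suc m) (suc n)) (F m (suc (suc n)))
    where
    commute : ∀ a b c d x y z → a · (c · x + d · y) + b · (c · y + d · z) ≡ c · (a · x + b · y) + d · (a · y + b · z)
    commute = solve 7 (λ a b c d x y z →
      a :* (c :* x :+ d :* y) :+ b :* (c :* y :+ d :* z)
      ⊜ (c :* (a :* x :+ b :* y) :+ d :* (a :* y :+ b :* z))) refl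

  mulLin-circular : ∀ F → Circular F → Circular (mulLin a b F)
  mulLin-circular F F-circular m n = begin
    mulLin a b F (2 ℕ.+ m) n + mulLin a b F m (2 ℕ.+ n)  ≡⟨ mulLin-+ (shift 2 0 F) (shift 0 2 F) m n ⟨
    mulLin a b (shift 2 0 F +ₜ shift 0 2 F) m n          ≡⟨ mulLin-cong F-circular m n ⟩
    mulLin a b (ι 4 ·ₜ F) m n                            ≡⟨ mulLin-· (ι 4) F m n ⟩
    ι 4 · mulLin a b F m n                               ∎
    where open ≡-Reasoning

  private
    T = mulLin a b

  iterate-cong : ∀ k {F G} → F ≗₂ G → iterate T k F ≗₂ iterate T k G
  iterate-cong zero    F≗G = F≗G
  iterate-cong (suc k) F≗G = iterate-cong k (mulLin-cong F≗G)

  iterate-+ : ∀ k F G → iterate T k (F +ₜ G) ≗₂ iterate T k F +ₜ iterate T k G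
  iterate-+ zero    F G m n = refl
  iterate-+ (suc k) F G m n =
    trans (iterate-cong k (mulLin-+ F G) m n) (iterate-+ k (T F) (T G) m n)

  iterate-· : ∀ k c F → iterate T k (c ·ₜ F) ≗₂ c ·ₜ iterate T k F
  iterate-· zero    c F m n = refl
  iterate-· (suc k) c F m n =
    trans (iterate-cong k (mulLin-· c F) m n) (iterate-· k c (T F) m n)

  iterate-comm : ∀ k c d F → iterate T k (mulLin c d F) ≗₂ mulLin c d (iterate T k F)
  iterate-comm zero    c d F m n = refl
  iterate-comm (suc k) c d F m n =
    trans (iterate-cong k (mulLin-comm c d F) m n) (iterate-comm k c d (T F) m n)

  iterate-circular : ∀ k F → Circular F → Circular (iterate T k F)
  iterate-circular zero    F F-circular = F-circular
  iterate-circular (suc k) F F-circular = iterate-circular k (T F) (mulLin-circular F F-circular)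

module _ (h : Mat2) where
  private
    a₁ = ↑ h₁₁ h
    b₁ = ↑ h₂₁ h
    a₂ = ↑ h₁₂ h
    b₂ = ↑ h₂₂ h
    A = mulLin a₁ b₁
    B = mulLin a₂ b₂

  transform-cong : ∀ {F G} → F ≗₂ G → transform h F ≗₂ transform h G
  transform-cong F≗G m n = iterate-cong a₂ b₂ n (iterate-cong a₁ b₁ m F≗G) 0 0

  transform-+ : ∀ F G → transform h (F +ₜ G) ≗₂ transform h F +ₜ transform h G
  transform-+ F G m n = trans (iterate-cong a₂ b₂ n (iterate-+ a₁ b₁ m F G) 0 0)
                              (iterate-+ a₂ b₂ n (iterate A m F) (iterate A m G) 0 0)

  transform-· : ∀ c F → transform h (c ·ₜ F) ≗₂ c ·ₜ transform h F
  transform-· c F m n = trans (iterate-cong a₂ b₂ n (iterate-· a₁ b₁ m c F) 0 0)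
                              (iterate-· a₂ b₂ n c (iterate A m F) 0 0)

  transform-suc₂ : ∀ F m n → transform h F m (suc n) ≡ transform h (B F) m n
  transform-suc₂ F m n = iterate-cong a₂ b₂ n (λ k l → sym (iterate-comm a₁ b₁ m a₂ b₂ F k l)) 0 0

module Moments (φ : Poly → ℚ) (φ-circular : CircularIntegralFunctional φ) where
  open CircularIntegralFunctional φ-circular

  moments : Table
  moments m n = ↑ φ (mono m n)

  φ-[] : φ [] ≡ 0ℚ
  φ-[] = trans (homog 0ℚ []) (ℚ.*-zeroˡ (φ []))

  ↑φ≡moments⟦⟧ : ∀ p → ↑ φ p ≡ moments ⟦ p ⟧
  ↑φ≡moments⟦⟧ []                = cong ↑_ φ-[]
  ↑φ≡moments⟦⟧ ((c , m , n) ∷ p) = begin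
    ↑ φ ((c , m , n) ∷ p)                 ≡⟨ cong ↑_ (additive _ p) ⟩
    ↑ φ ((c , m , n) ∷ []) + ↑ φ p
      ≡⟨ cong₂ _+_ (cong ↑_ (trans φ-term (homog c (mono m n)))) (↑φ≡moments⟦⟧ p) ⟩
    ↑ (c ℚ.* φ (mono m n)) + moments ⟦ p ⟧     ≡⟨ cong (λ t → t + moments ⟦ p ⟧) (↑-homo-* c _) ⟩
    ↑ c · moments m n + moments ⟦ p ⟧          ∎
    where
    open ≡-Reasoning
    φ-term : φ ((c , m , n) ∷ []) ≡ φ (scale c (mono m n))
    φ-term = cong (λ d → φ ((d , m , n) ∷ [])) (sym (ℚ.*-identityʳ c))

  moments-invariant : ∀ h → InSO2 h → transform h moments ≗₂ moments
  moments-invariant h h∈SO2 m n = begin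
    transform h moments m n        ≡⟨ ⟦⟧-act-mono moments h m n ⟨
    moments ⟦ act h (mono m n) ⟧   ≡⟨ ↑φ≡moments⟦⟧ _ ⟨
    ↑ φ (act h (mono m n))         ≡⟨ cong ↑_ (invariance h h∈SO2 (mono m n)) ⟩
    moments m n                    ∎
    where open ≡-Reasoning

  moments-circular : Circular moments
  moments-circular m n = begin
    A + B                                     ≡⟨ rearrange A B C ⟩
    (↑ 1ℚ · A + (↑ 1ℚ · B + (↑ −4 · C + 0ᵢ))) + ι 4 · C  ≡⟨ cong (λ t → t + ι 4 · C) vanishes ⟩
    0ᵢ + ι 4 · C                              ≡⟨ +-identityˡ _ ⟩
    ι 4 · C                                   ∎
    where
    open ≡-Reasoning
    A = moments (suc (suc m)) n
    B = moments m (suc (suc n))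
    C = moments m n
    −4 : ℚ
    −4 = ℚ.- (+ 4 / 1)
    p : Poly
    p = (1ℚ , suc (suc m) , n) ∷ (1ℚ , m , suc (suc n)) ∷ (−4 , m , n) ∷ []
    rearrange : ∀ a b c → a + b ≡ (↑ 1ℚ · a + (↑ 1ℚ · b + (↑ −4 · c + 0ᵢ))) + ι 4 · c
    rearrange = solve 3 (λ a b c →
      a :+ b
      ⊜ (Κ (↑ 1ℚ) :* a :+ (Κ (↑ 1ℚ) :* b :+ (Κ (↑ −4) :* c :+ Κ 0ᵢ)) :+ Κ (ι 4) :* c)) refl
    eval-p : ∀ x y → x ℚ.* x ℚ.+ y ℚ.* y ≡ radius ℚ.* radius → eval p x y ≡ 0ℚ
    eval-p x y on-circle = begin
      eval p x y                              ≡⟨ factor x y (powℚ x m) (powℚ y n) ⟩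
      (x ℚ.* x ℚ.+ y ℚ.* y ℚ.+ −4) ℚ.* powℚ x m ℚ.* powℚ y n
        ≡⟨ cong (λ r → (r ℚ.+ −4) ℚ.* powℚ x m ℚ.* powℚ y n) on-circle ⟩
      (radius ℚ.* radius ℚ.+ −4) ℚ.* powℚ x m ℚ.* powℚ y n ≡⟨ vanish (powℚ x m) (powℚ y n) ⟩
      0ℚ ∎
      where
      factor : ∀ x y X Y → 1ℚ ℚ.* (x ℚ.* (x ℚ.* X)) ℚ.* Y ℚ.+ (1ℚ ℚ.* X ℚ.* (y ℚ.* (y ℚ.* Y)) ℚ.+ (−4 ℚ.* X ℚ.* Y ℚ.+ 0ℚ))
                         ≡ (x ℚ.* x ℚ.+ y ℚ.* y ℚ.+ −4) ℚ.* X ℚ.* Y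
      factor = ℚ-Solver.solve 4 (λ x y X Y →
        Κ 1ℚ :* (x :* (x :* X)) :* Y :+ (Κ 1ℚ :* X :* (y :* (y :* Y)) :+ (Κ −4 :* X :* Y :+ Κ 0ℚ))
        ℚ-Solver.⊜ (x :* x :+ y :* y :+ Κ −4) :* X :* Y) refl
      vanish : ∀ X Y → (radius ℚ.* radius ℚ.+ −4) ℚ.* X ℚ.* Y ≡ 0ℚ
      vanish = ℚ-Solver.solve 2 (λ X Y →
        (Κ radius :* Κ radius :+ Κ −4) :* X :* Y
        ℚ-Solver.⊜ Κ 0ℚ) refl
    vanishes : moments ⟦ p ⟧ ≡ 0ᵢ
    vanishes = trans (sym (↑φ≡moments⟦⟧ p)) (cong ↑_ (locality p eval-p))

-- Invariance under a rotation of infinite order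

rotation : ℚ → ℚ → Mat2
rotation c s = mat c (ℚ.- s) s c

module _ (c s : ℚ) (e : ℚ[i]) (e²≡-1 : e · e ≡ - 1ᵢ) where
  private
    R = rotation c s
    A = mulLin (↑ c) (↑ s)
    B = mulLin (- ↑ s) (↑ c)
    Zₑ = mulLin 1ᵢ e
    ω = ↑ c - e · ↑ s

  mulLin-rotation : ∀ F → A F +ₜ e ·ₜ B F ≗₂ ω ·ₜ Zₑ F
  mulLin-rotation F m n = begin
    ↑ c · x + ↑ s · y + e · (- ↑ s · x + ↑ c · y)        ≡⟨ expand (↑ c) (↑ s) e x y ⟩
    ω · (1ᵢ · x + e · y) + (e · e + 1ᵢ) · (↑ s · y)
      ≡⟨ cong (λ t → ω · (1ᵢ · x + e · y) + t) (e²+1≡0 e e²≡-1 (↑ s · y)) ⟩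
    ω · (1ᵢ · x + e · y) + 0ᵢ                             ≡⟨ +-identityʳ (ω · (1ᵢ · x + e · y)) ⟩
    ω · (1ᵢ · x + e · y)                                  ∎
    where
    open ≡-Reasoning
    x = F (suc m) n
    y = F m (suc n)
    expand : ∀ c s e x y → c · x + s · y + e · (- s · x + c · y) ≡ (c - e · s) · (1ᵢ · x + e · y) + (e · e + 1ᵢ) · (s · y)
    expand = solve 5 (λ c s e x y →
      c :* x :+ s :* y :+ e :* (:- s :* x :+ c :* y)
      ⊜ ((c :+ :- (e :* s)) :* (Κ 1ᵢ :* x :+ e :* y) :+ (e :* e :+ Κ 1ᵢ) :* (s :* y))) refl

  Zₑ-transform : ∀ F → Zₑ (transform R F) ≗₂ ω ·ₜ transform R (Zₑ F)
  Zₑ-transform F m n = begin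
    1ᵢ · transform R F (suc m) n + e · transform R F m (suc n)
      ≡⟨ cong₂ (λ x y → x + e · y) (·-identityˡ (transform R F (suc m) n)) (transform-suc₂ R F m n) ⟩
    transform R (A F) m n + e · transform R (B F) m n
      ≡⟨ cong (λ t → transform R (A F) m n + t) (transform-· R e (B F) m n) ⟨
    transform R (A F) m n + transform R (e ·ₜ B F) m n
      ≡⟨ transform-+ R (A F) (e ·ₜ B F) m n ⟨
    transform R (A F +ₜ e ·ₜ B F) m n
      ≡⟨ transform-cong R (mulLin-rotation F) m n ⟩
    transform R (ω ·ₜ Zₑ F) m n
      ≡⟨ transform-· R ω (Zₑ F) m n ⟩
    ω · transform R (Zₑ F) m n ∎
    where open ≡-Reasoning

  Zₑ^-transform : ∀ k F → iterate Zₑ k (transform R F) ≗₂ (ω ^ k) ·ₜ transform R (iterate Zₑ k F)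
  Zₑ^-transform zero    F m n = sym (·-identityˡ (transform R F m n))
  Zₑ^-transform (suc k) F m n = begin
    iterate Zₑ k (Zₑ (transform R F)) m n                  ≡⟨ iterate-cong 1ᵢ e k (Zₑ-transform F) m n ⟩
    iterate Zₑ k (ω ·ₜ transform R (Zₑ F)) m n             ≡⟨ iterate-· 1ᵢ e k ω (transform R (Zₑ F)) m n ⟩
    ω · iterate Zₑ k (transform R (Zₑ F)) m n              ≡⟨ cong (ω ·_) (Zₑ^-transform k (Zₑ F) m n) ⟩
    ω · (ω ^ k · transform R (iterate Zₑ k (Zₑ F)) m n)
      ≡⟨ ·-assoc ω (ω ^ k) (transform R (iterate Zₑ (suc k) F) m n) ⟨
    ω ^ suc k · transform R (iterate Zₑ (suc k) F) m n    ∎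
    where open ≡-Reasoning

  Zₑ^-vanishes : ∀ F → transform R F ≗₂ F → (∀ k → ω ^ suc k ≢ 1ᵢ) → ∀ k → iterate Zₑ (suc k) F 0 0 ≡ 0ᵢ
  Zₑ^-vanishes F invariant ω^≢1 k = v≡w·v⇒v≡0 (ω^≢1 k) (begin
    iterate Zₑ (suc k) F 0 0                              ≡⟨ iterate-cong 1ᵢ e (suc k) invariant 0 0 ⟨
    iterate Zₑ (suc k) (transform R F) 0 0                ≡⟨ Zₑ^-transform (suc k) F 0 0 ⟩
    ω ^ suc k · iterate Zₑ (suc k) F 0 0                  ∎)
    where open ≡-Reasoning

ℤ[i] : Set
ℤ[i] = ℤ × ℤ

⌜_⌝ : ℤ[i] → ℚ[i]
⌜ (x , y) ⌝ = (x / 1 , y / 1)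

times3-4i : ℤ[i] → ℤ[i]
times3-4i (x , y) = (+ 3 ℤ.* x ℤ.+ + 4 ℤ.* y , + 3 ℤ.* y ℤ.+ ℤ.- + 4 ℤ.* x)

⌜⌝-times3-4i : ∀ z → ⌜ (+ 3 , ℤ.- + 4) ⌝ · ⌜ z ⌝ ≡ ⌜ times3-4i z ⌝
⌜⌝-times3-4i (x , y) = cong₂ _,_
  (trans (re (x / 1) (y / 1)) (sym (embed (+ 3) x (+ 4) y)))
  (sym (embed (+ 3) y (ℤ.- + 4) x))
  where
  embed : ∀ a x b y → (a ℤ.* x ℤ.+ b ℤ.* y) / 1 ≡ (a / 1) ℚ.* (x / 1) ℚ.+ (b / 1) ℚ.* (y / 1)
  embed a x b y = trans (/1-homo-+ (a ℤ.* x) (b ℤ.* y)) (cong₂ ℚ._+_ (/1-homo-* a x) (/1-homo-* b y))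
  re : ∀ X Y → (+ 3 / 1) ℚ.* X ℚ.- (ℤ.- + 4 / 1) ℚ.* Y ≡ (+ 3 / 1) ℚ.* X ℚ.+ (+ 4 / 1) ℚ.* Y
  re = ℚ-Solver.solve 2 (λ X Y →
    Κ (+ 3 / 1) :* X :+ :- (Κ (ℤ.- + 4 / 1) :* Y)
    ℚ-Solver.⊜ (Κ (+ 3 / 1) :* X :+ Κ (+ 4 / 1) :* Y)) refl

ω₀ ω̄₀ : ℚ[i]
ω₀ = (+ 3 / 5 , ℚ.- (+ 4 / 5))
ω̄₀ = (+ 3 / 5 , + 4 / 5)

pow3-4i : ℕ → ℤ[i]
pow3-4i zero    = (+ 1 , + 0)
pow3-4i (suc k) = times3-4i (pow3-4i k)

5ω₀^≡pow3-4i : ∀ k → (ι 5 · ω₀) ^ k ≡ ⌜ pow3-4i k ⌝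
5ω₀^≡pow3-4i zero    = refl
5ω₀^≡pow3-4i (suc k) = trans (cong (ι 5 · ω₀ ·_) (5ω₀^≡pow3-4i k)) (⌜⌝-times3-4i (pow3-4i k))

pow3-4i-mod5 : ∀ k → ∃₂ λ a b → pow3-4i (suc k) ≡ (+ 5 ℤ.* a ℤ.+ + 3 , + 5 ℤ.* b ℤ.+ + 1)
pow3-4i-mod5 zero = + 0 , ℤ.- + 1 , refl
pow3-4i-mod5 (suc k) with pow3-4i-mod5 k
... | a , b , eq = + 3 ℤ.* a ℤ.+ + 4 ℤ.* b ℤ.+ + 2 , + 3 ℤ.* b ℤ.- + 4 ℤ.* a ℤ.- + 2 ,
  trans (cong times3-4i eq) (cong₂ _,_ (re a b) (im a b))
  where
  re : ∀ a b → + 3 ℤ.* (+ 5 ℤ.* a ℤ.+ + 3) ℤ.+ + 4 ℤ.* (+ 5 ℤ.* b ℤ.+ + 1)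
             ≡ + 5 ℤ.* (+ 3 ℤ.* a ℤ.+ + 4 ℤ.* b ℤ.+ + 2) ℤ.+ + 3
  re = ℤ-Solver.solve-∀
  im : ∀ a b → + 3 ℤ.* (+ 5 ℤ.* b ℤ.+ + 1) ℤ.+ ℤ.- + 4 ℤ.* (+ 5 ℤ.* a ℤ.+ + 3)
             ≡ + 5 ℤ.* (+ 3 ℤ.* b ℤ.- + 4 ℤ.* a ℤ.- + 2) ℤ.+ + 1
  im = ℤ-Solver.solve-∀

5b+1≢0 : ∀ b → + 5 ℤ.* b ℤ.+ + 1 ≢ + 0
5b+1≢0 b 5b+1≡0 with ℕ.∣1⇒≡1 (ℕ.divides ℤ.∣ ℤ.- b ∣ 1≡∣-b∣*5)
  where
  1≡5*-b : + 1 ≡ + 5 ℤ.* ℤ.- b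
  1≡5*-b = trans (rearrange b) (trans (cong (λ t → + 5 ℤ.* ℤ.- b ℤ.+ t) 5b+1≡0) (ℤ.+-identityʳ (+ 5 ℤ.* ℤ.- b)))
    where
    rearrange : ∀ b → + 1 ≡ + 5 ℤ.* ℤ.- b ℤ.+ (+ 5 ℤ.* b ℤ.+ + 1)
    rearrange = ℤ-Solver.solve-∀
  1≡∣-b∣*5 : 1 ≡ ℤ.∣ ℤ.- b ∣ ℕ.* 5
  1≡∣-b∣*5 = trans (cong ℤ.∣_∣ 1≡5*-b) (trans (ℤ.abs-* (+ 5) (ℤ.- b)) (ℕ.*-comm 5 ℤ.∣ ℤ.- b ∣))
... | ()

ω₀^suc≢1 : ∀ k → ω₀ ^ suc k ≢ 1ᵢ
ω₀^suc≢1 k ω₀^≡1 with pow3-4i-mod5 k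
... | a , b , eq = 5b+1≢0 b (/1-injective (begin
  (+ 5 ℤ.* b ℤ.+ + 1) / 1                        ≡⟨ cong (λ z → proj₂ ⌜ z ⌝) eq ⟨
  proj₂ ⌜ pow3-4i (suc k) ⌝                      ≡⟨ cong proj₂ (5ω₀^≡pow3-4i (suc k)) ⟨
  proj₂ ((ι 5 · ω₀) ^ suc k)                     ≡⟨ cong proj₂ (^-distrib-* (ι 5) ω₀ (suc k)) ⟩
  proj₂ (ι 5 ^ suc k · ω₀ ^ suc k)               ≡⟨ cong (λ w → proj₂ (ι 5 ^ suc k · w)) ω₀^≡1 ⟩
  proj₂ (ι 5 ^ suc k · 1ᵢ)                       ≡⟨ cong proj₂ (trans (·-identityʳ _) (ι-homo-^ 5 (suc k))) ⟩
  proj₂ (ι (5 ℕ.^ suc k))                        ≡⟨ cong proj₂ (ι≡↑n/1 (5 ℕ.^ suc k)) ⟩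
  0ℚ                                             ∎))
  where open ≡-Reasoning

ω̄₀^suc≢1 : ∀ k → ω̄₀ ^ suc k ≢ 1ᵢ
ω̄₀^suc≢1 k ω̄₀^≡1 = ω₀^suc≢1 k (begin
  ω₀ ^ suc k                    ≡⟨ ·-identityʳ (ω₀ ^ suc k) ⟨
  ω₀ ^ suc k · 1ᵢ               ≡⟨ cong (ω₀ ^ suc k ·_) ω̄₀^≡1 ⟨
  ω₀ ^ suc k · ω̄₀ ^ suc k       ≡⟨ ^-distrib-* ω₀ ω̄₀ (suc k) ⟨
  (ω₀ · ω̄₀) ^ suc k             ≡⟨ 1ᵢ^n≡1ᵢ (suc k) ⟩
  1ᵢ                            ∎)
  where open ≡-Reasoning

-- The angular derivation

Z Z̄ : Table → Table
Z  = mulLin 1ᵢ i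
Z̄ = mulLin 1ᵢ (- i)

Z∘Z̄ : ∀ F m n → Z (Z̄ F) m n ≡ F (2 ℕ.+ m) n + F m (2 ℕ.+ n)
Z∘Z̄ F m n = expand (F (2 ℕ.+ m) n) (F (suc m) (suc n)) (F m (2 ℕ.+ n))
  where
  expand : ∀ x y z → 1ᵢ · (1ᵢ · x + - i · y) + i · (1ᵢ · y + - i · z) ≡ x + z
  expand = solve 3 (λ x y z →
    Κ 1ᵢ :* (Κ 1ᵢ :* x :+ :- Κ i :* y) :+ Κ i :* (Κ 1ᵢ :* y :+ :- Κ i :* z)
    ⊜ (x :+ z)) refl

-- ∂θ F is the table of p ↦ F ⟦ D p ⟧ for D = α₁∂₂ - α₂∂₁. When m or n is 0 the junk
-- index ℕ.pred 0 = 0 is harmless: its coefficient ι 0 vanishes.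
∂θ : Table → Table
∂θ F m n = ι n · F (suc m) (ℕ.pred n) - ι m · F (ℕ.pred m) (suc n)

∂θ-cong : ∀ {F G} → F ≗₂ G → ∂θ F ≗₂ ∂θ G
∂θ-cong F≗G m n = cong₂ (λ x y → ι n · x - ι m · y) (F≗G (suc m) (ℕ.pred n)) (F≗G (ℕ.pred m) (suc n))

∂θ-origin : ∀ F → ∂θ F 0 0 ≡ 0ᵢ
∂θ-origin F = vanish (F 1 0) (F 0 1)
  where
  vanish : ∀ x y → 0ᵢ · x - 0ᵢ · y ≡ 0ᵢ
  vanish = solve 2 (λ x y → Κ 0ᵢ :* x :+ :- (Κ 0ᵢ :* y) ⊜ Κ 0ᵢ) refl

ι·-pred : ∀ n (f : ℕ → ℚ[i]) → ι n · f n ≡ ι n · f (suc (ℕ.pred n))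
ι·-pred zero    f = trans (·-zeroˡ (f 0)) (sym (·-zeroˡ (f 1)))
ι·-pred (suc n) f = refl

mulLin-∂θ : ∀ e → e · e ≡ - 1ᵢ → ∀ F m n →
            mulLin 1ᵢ e (∂θ F) m n ≡ ∂θ (mulLin 1ᵢ e F) m n + e · mulLin 1ᵢ e F m n
mulLin-∂θ e e²≡-1 F m n = begin
  1ᵢ · (u · A - (1ᵢ + v) · B) + e · ((1ᵢ + u) · C - v · D)
    ≡⟨ expand e u v A B C D ⟩
  X - (e · e + 1ᵢ) · B                                   ≡⟨ cong (λ t → X - t) (e²+1≡0 e e²≡-1 B) ⟩
  X - 0ᵢ                                                 ≡⟨ +-identityʳ X ⟩
  u · (1ᵢ · A + e · C) - v · (1ᵢ · B + e · D) + e · (1ᵢ · C + e · B)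
    ≡⟨ cong₂ (λ x y → x - y + e · (1ᵢ · C + e · B)) (ι·-pred n (λ k → 1ᵢ · A + e · F (suc m) k))
                                                     (ι·-pred m (λ k → 1ᵢ · F k (suc n) + e · D)) ⟩
  ∂θ (mulLin 1ᵢ e F) m n + e · mulLin 1ᵢ e F m n         ∎
  where
  open ≡-Reasoning
  u = ι n
  v = ι m
  A = F (2 ℕ.+ m) (ℕ.pred n)
  B = F m (suc n)
  C = F (suc m) n
  D = F (ℕ.pred m) (2 ℕ.+ n)
  X = u · (1ᵢ · A + e · C) - v · (1ᵢ · B + e · D) + e · (1ᵢ · C + e · B)
  expand : ∀ e u v A B C D →
    1ᵢ · (u · A - (1ᵢ + v) · B) + e · ((1ᵢ + u) · C - v · D) ≡
    (u · (1ᵢ · A + e · C) - v · (1ᵢ · B + e · D) + e · (1ᵢ · C + e · B)) - (e · e + 1ᵢ) · B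
  expand = solve 7 (λ e u v A B C D →
    Κ 1ᵢ :* (u :* A :+ :- ((Κ 1ᵢ :+ v) :* B)) :+ e :* ((Κ 1ᵢ :+ u) :* C :+ :- (v :* D))
    ⊜ (u :* (Κ 1ᵢ :* A :+ e :* C) :+ :- (v :* (Κ 1ᵢ :* B :+ e :* D)) :+ e :* (Κ 1ᵢ :* C :+ e :* B) :+ :- ((e :* e :+ Κ 1ᵢ) :* B))) refl

half : ℚ[i]
half = ↑ (+ 1 / 2)

α₁-via-z : ∀ F m n → F (suc m) n ≡ half · (Z F m n + Z̄ F m n)
α₁-via-z F m n = identity (F (suc m) n) (F m (suc n))
  where
  identity : ∀ x y → x ≡ half · ((1ᵢ · x + i · y) + (1ᵢ · x + - i · y))
  identity = solve 2 (λ x y →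
    x
    ⊜ Κ half :* (Κ 1ᵢ :* x :+ Κ i :* y :+ (Κ 1ᵢ :* x :+ :- Κ i :* y))) refl

α₂-via-z : ∀ F m n → F m (suc n) ≡ - i · half · (Z F m n - Z̄ F m n)
α₂-via-z F m n = identity (F (suc m) n) (F m (suc n))
  where
  identity : ∀ x y → y ≡ - i · half · ((1ᵢ · x + i · y) - (1ᵢ · x + - i · y))
  identity = solve 2 (λ x y →
    y
    ⊜ :- Κ i :* Κ half :* (Κ 1ᵢ :* x :+ Κ i :* y :+ :- (Κ 1ᵢ :* x :+ :- Κ i :* y))) refl

-- If F a b is the table of p ↦ φ(z^a z̄^b p) then, as D(z^a z̄^b) = i(a - b) z^a z̄^b, the
-- Leibniz rule (mulLin-∂θ) turns φ(z^a z̄^b D p) into i(b - a) φ(z^a z̄^b p). The induction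
-- on the monomial p writes α₁ = (z + z̄)/2 and α₂ = (z - z̄)/2i; the base case is the
-- vanishing of the off-diagonal values.
module Eigen (F : ℕ → ℕ → Table)
             (Z-step : ∀ a b → Z (F a b) ≗₂ F (suc a) b)
             (Z̄-step : ∀ a b → Z̄ (F a b) ≗₂ F a (suc b))
             (off-diagonal : ∀ a b → a ≢ b → F a b 0 0 ≡ 0ᵢ) where

  eigenvalue : ℕ → ℕ → ℚ[i]
  eigenvalue a b = i · (ι b - ι a)

  EigenAt : ℕ → ℕ → Set
  EigenAt m n = ∀ a b → ∂θ (F a b) m n ≡ eigenvalue a b · F a b m n

  private
    eigen-base : EigenAt 0 0
    eigen-base a b = trans (∂θ-origin (F a b)) (sym (eigen-origin a b))
      where
      eigen-origin : ∀ a b → eigenvalue a b · F a b 0 0 ≡ 0ᵢ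
      eigen-origin a b with a ℕ.≟ b
      ... | yes refl = diagonal (ι a) (F a a 0 0)
        where
        diagonal : ∀ u x → i · (u - u) · x ≡ 0ᵢ
        diagonal = solve 2 (λ u x → Κ i :* (u :+ :- u) :* x ⊜ Κ 0ᵢ) refl
      ... | no a≢b   = trans (cong (eigenvalue a b ·_) (off-diagonal a b a≢b)) (·-zeroʳ (eigenvalue a b))

    module Step (m n : ℕ) (eigen : EigenAt m n) (a b : ℕ) where
      G = F a b
      ZG = Z G m n
      Z̄G = Z̄ G m n

      Z-eigen : ∂θ (Z G) m n ≡ eigenvalue (suc a) b · ZG
      Z-eigen = trans (∂θ-cong (Z-step a b) m n)
                      (trans (eigen (suc a) b) (cong (eigenvalue (suc a) b ·_) (sym (Z-step a b m n))))

      Z̄-eigen : ∂θ (Z̄ G) m n ≡ eigenvalue a (suc b) · Z̄G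
      Z̄-eigen = trans (∂θ-cong (Z̄-step a b) m n)
                      (trans (eigen a (suc b)) (cong (eigenvalue a (suc b) ·_) (sym (Z̄-step a b m n))))

      Z∂θ : Z (∂θ G) m n ≡ eigenvalue (suc a) b · ZG + i · ZG
      Z∂θ = trans (mulLin-∂θ i refl G m n) (cong (λ t → t + i · ZG) Z-eigen)

      Z̄∂θ : Z̄ (∂θ G) m n ≡ eigenvalue a (suc b) · Z̄G + - i · Z̄G
      Z̄∂θ = trans (mulLin-∂θ (- i) refl G m n) (cong (λ t → t + - i · Z̄G) Z̄-eigen)

      step₁ : ∂θ G (suc m) n ≡ eigenvalue a b · G (suc m) n
      step₁ = begin
        ∂θ G (suc m) n                                  ≡⟨ α₁-via-z (∂θ G) m n ⟩
        half · (Z (∂θ G) m n + Z̄ (∂θ G) m n)           ≡⟨ cong₂ (λ x y → half · (x + y)) Z∂θ Z̄∂θ ⟩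
        half · ((eigenvalue (suc a) b · ZG + i · ZG) + (eigenvalue a (suc b) · Z̄G + - i · Z̄G))
                                                        ≡⟨ regroup (ι a) (ι b) ZG Z̄G ⟩
        eigenvalue a b · (half · (ZG + Z̄G))            ≡⟨ cong (eigenvalue a b ·_) (α₁-via-z G m n) ⟨
        eigenvalue a b · G (suc m) n                    ∎
        where
        open ≡-Reasoning
        regroup : ∀ α β x y → half · ((i · (β - (1ᵢ + α)) · x + i · x) + (i · ((1ᵢ + β) - α) · y + - i · y))
                              ≡ i · (β - α) · (half · (x + y))
        regroup = solve 4 (λ α β x y →
          Κ half :* (Κ i :* (β :+ :- (Κ 1ᵢ :+ α)) :* x :+ Κ i :* x :+ (Κ i :* (Κ 1ᵢ :+ β :+ :- α) :* y :+ :- Κ i :* y))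
          ⊜ Κ i :* (β :+ :- α) :* (Κ half :* (x :+ y))) refl

      step₂ : ∂θ G m (suc n) ≡ eigenvalue a b · G m (suc n)
      step₂ = begin
        ∂θ G m (suc n)                                  ≡⟨ α₂-via-z (∂θ G) m n ⟩
        - i · half · (Z (∂θ G) m n - Z̄ (∂θ G) m n)     ≡⟨ cong₂ (λ x y → - i · half · (x - y)) Z∂θ Z̄∂θ ⟩
        - i · half · ((eigenvalue (suc a) b · ZG + i · ZG) - (eigenvalue a (suc b) · Z̄G + - i · Z̄G))
                                                        ≡⟨ regroup (ι a) (ι b) ZG Z̄G ⟩
        eigenvalue a b · (- i · half · (ZG - Z̄G))      ≡⟨ cong (eigenvalue a b ·_) (α₂-via-z G m n) ⟨
        eigenvalue a b · G m (suc n)                    ∎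
        where
        open ≡-Reasoning
        regroup : ∀ α β x y → - i · half · ((i · (β - (1ᵢ + α)) · x + i · x) - (i · ((1ᵢ + β) - α) · y + - i · y))
                              ≡ i · (β - α) · (- i · half · (x - y))
        regroup = solve 4 (λ α β x y →
          :- Κ i :* Κ half :* (Κ i :* (β :+ :- (Κ 1ᵢ :+ α)) :* x :+ Κ i :* x :+ :- (Κ i :* (Κ 1ᵢ :+ β :+ :- α) :* y :+ :- Κ i :* y))
          ⊜ Κ i :* (β :+ :- α) :* (:- Κ i :* Κ half :* (x :+ :- y))) refl

  ∂θ-eigen : ∀ m n → EigenAt m n
  ∂θ-eigen zero    zero    = eigen-base
  ∂θ-eigen zero    (suc n) = Step.step₂ 0 n (∂θ-eigen 0 n)
  ∂θ-eigen (suc m) n       = Step.step₁ m n (∂θ-eigen m n)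

module Family (G : Table) where

  family : ℕ → ℕ → Table
  family a b = iterate Z a (iterate Z̄ b G)

  Z-family : ∀ a b → Z (family a b) ≗₂ family (suc a) b
  Z-family a b m n = sym (iterate-comm 1ᵢ i a 1ᵢ i (iterate Z̄ b G) m n)

  Z̄-family : ∀ a b → Z̄ (family a b) ≗₂ family a (suc b)
  Z̄-family a b m n = begin
    Z̄ (iterate Z a (iterate Z̄ b G)) m n    ≡⟨ iterate-comm 1ᵢ i a 1ᵢ (- i) (iterate Z̄ b G) m n ⟨
    iterate Z a (Z̄ (iterate Z̄ b G)) m n
      ≡⟨ iterate-cong 1ᵢ i a (λ k l → sym (iterate-comm 1ᵢ (- i) b 1ᵢ (- i) G k l)) m n ⟩
    iterate Z a (iterate Z̄ (suc b) G) m n  ∎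
    where open ≡-Reasoning

  module _ (G-circular : Circular G) where

    family-circular : ∀ a b → Circular (family a b)
    family-circular a b = iterate-circular 1ᵢ i a _ (iterate-circular 1ᵢ (- i) b G G-circular)

    family-diagonal : ∀ a b → family (suc a) (suc b) 0 0 ≡ ι 4 · family a b 0 0
    family-diagonal a b = begin
      family (suc a) (suc b) 0 0         ≡⟨ Z-family a (suc b) 0 0 ⟨
      Z (family a (suc b)) 0 0           ≡⟨ mulLin-cong 1ᵢ i (λ m n → sym (Z̄-family a b m n)) 0 0 ⟩
      Z (Z̄ (family a b)) 0 0            ≡⟨ Z∘Z̄ (family a b) 0 0 ⟩
      family a b 2 0 + family a b 0 2    ≡⟨ family-circular a b 0 0 ⟩
      ι 4 · family a b 0 0               ∎
      where open ≡-Reasoning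

    module _ (G-invariant : transform (rotation (+ 3 / 5) (+ 4 / 5)) G ≗₂ G) where

      family-off-diagonal : ∀ a b → a ≢ b → family a b 0 0 ≡ 0ᵢ
      family-off-diagonal zero    zero    a≢b = ⊥-elim (a≢b refl)
      family-off-diagonal (suc a) zero    _   =
        Zₑ^-vanishes (+ 3 / 5) (+ 4 / 5) i refl G G-invariant ω₀^suc≢1 a
      family-off-diagonal zero    (suc b) _   =
        Zₑ^-vanishes (+ 3 / 5) (+ 4 / 5) (- i) refl G G-invariant ω̄₀^suc≢1 b
      family-off-diagonal (suc a) (suc b) a≢b = begin
        family (suc a) (suc b) 0 0         ≡⟨ family-diagonal a b ⟩
        ι 4 · family a b 0 0               ≡⟨ cong (ι 4 ·_) (family-off-diagonal a b (a≢b ∘ cong suc)) ⟩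
        ι 4 · 0ᵢ                           ≡⟨ ·-zeroʳ (ι 4) ⟩
        0ᵢ                                 ∎
        where open ≡-Reasoning

      open Eigen family Z-family Z̄-family family-off-diagonal

      balance : ∀ m n → ι (suc n) · G (2 ℕ.+ m) n ≡ ι (suc m) · G m (2 ℕ.+ n)
      balance m n = begin
        ι (suc n) · X                                  ≡⟨ split (ι (suc n) · X) (ι (suc m) · Y) ⟩
        (ι (suc n) · X - ι (suc m) · Y) + ι (suc m) · Y
          ≡⟨ cong (λ t → t + ι (suc m) · Y) (∂θ-eigen (suc m) (suc n) 0 0) ⟩
        eigenvalue 0 0 · G (suc m) (suc n) + ι (suc m) · Y
          ≡⟨ cong (λ t → t + ι (suc m) · Y) (·-zeroˡ (G (suc m) (suc n))) ⟩
        0ᵢ + ι (suc m) · Y                             ≡⟨ +-identityˡ (ι (suc m) · Y) ⟩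
        ι (suc m) · Y                                  ∎
        where
        open ≡-Reasoning
        X = G (2 ℕ.+ m) n
        Y = G m (2 ℕ.+ n)
        split : ∀ y z → y ≡ (y - z) + z
        split = solve 2 (λ y z → y ⊜ (y :+ :- z :+ z)) refl

-- The closed form

denominator numerator : ℕ → ℕ → ℕ
denominator m n = m ! ℕ.* n ! ℕ.* (m ℕ.+ n) !
numerator   m n = (2 ℕ.* m) ! ℕ.* (2 ℕ.* n) !

denominator≢0 : ∀ m n → ℕ.NonZero (denominator m n)
denominator≢0 m n = ℕ.m*n≢0 (m ! ℕ.* n !) ((m ℕ.+ n) !) {{m ℕ.!* n !≢0}} {{(m ℕ.+ n) ℕ.!≢0}}

private
  2*suc : ∀ m → 2 ℕ.* suc m ≡ suc (suc (2 ℕ.* m))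
  2*suc m = ℕ.*-suc 2 m

  denominator-suc₁ : ∀ m n → denominator (suc m) n ≡ suc m ℕ.* suc (m ℕ.+ n) ℕ.* denominator m n
  denominator-suc₁ m n = identity (suc m) (m !) (n !) (suc (m ℕ.+ n)) ((m ℕ.+ n) !)
    where
    identity : ∀ a b c d e → a ℕ.* b ℕ.* c ℕ.* (d ℕ.* e) ≡ a ℕ.* d ℕ.* (b ℕ.* c ℕ.* e)
    identity = ℕ-Solver.solve-∀

  denominator-suc₂ : ∀ m n → denominator m (suc n) ≡ suc n ℕ.* suc (m ℕ.+ n) ℕ.* denominator m n
  denominator-suc₂ m n rewrite ℕ.+-suc m n = identity (m !) (suc n) (n !) (suc (m ℕ.+ n)) ((m ℕ.+ n) !)
    where
    identity : ∀ a b c d e → a ℕ.* (b ℕ.* c) ℕ.* (d ℕ.* e) ≡ b ℕ.* d ℕ.* (a ℕ.* c ℕ.* e)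
    identity = ℕ-Solver.solve-∀

  numerator-suc₁ : ∀ m n → numerator (suc m) n ≡ suc (suc (2 ℕ.* m)) ℕ.* suc (2 ℕ.* m) ℕ.* numerator m n
  numerator-suc₁ m n = trans (cong (λ k → k ! ℕ.* (2 ℕ.* n) !) (2*suc m))
                             (identity (2 ℕ.* m) ((2 ℕ.* m) !) ((2 ℕ.* n) !))
    where
    identity : ∀ a b c → (2 ℕ.+ a) ℕ.* ((1 ℕ.+ a) ℕ.* b) ℕ.* c ≡ (2 ℕ.+ a) ℕ.* (1 ℕ.+ a) ℕ.* (b ℕ.* c)
    identity = ℕ-Solver.solve-∀

  numerator-suc₂ : ∀ m n → numerator m (suc n) ≡ suc (suc (2 ℕ.* n)) ℕ.* suc (2 ℕ.* n) ℕ.* numerator m n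
  numerator-suc₂ m n = trans (cong (λ k → (2 ℕ.* m) ! ℕ.* k !) (2*suc n))
                             (identity (2 ℕ.* n) ((2 ℕ.* m) !) ((2 ℕ.* n) !))
    where
    identity : ∀ a b c → b ℕ.* ((2 ℕ.+ a) ℕ.* ((1 ℕ.+ a) ℕ.* c)) ≡ (2 ℕ.+ a) ℕ.* (1 ℕ.+ a) ℕ.* (b ℕ.* c)
    identity = ℕ-Solver.solve-∀

  ι-2+2m : ∀ m → ι (suc (suc (2 ℕ.* m))) ≡ ι 2 · ι (suc m)
  ι-2+2m m = trans (cong ι (sym (2*suc m))) (ι-homo-* 2 (suc m))

  ι-odd+odd : ∀ m n → ι (suc (2 ℕ.* m)) + ι (suc (2 ℕ.* n)) ≡ ι 2 · ι (suc (m ℕ.+ n))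
  ι-odd+odd m n = begin
    (1ᵢ + ι (2 ℕ.* m)) + (1ᵢ + ι (2 ℕ.* n))
      ≡⟨ cong₂ (λ x y → (1ᵢ + x) + (1ᵢ + y)) (ι-homo-* 2 m) (ι-homo-* 2 n) ⟩
    (1ᵢ + ι 2 · ι m) + (1ᵢ + ι 2 · ι n)             ≡⟨ identity (ι m) (ι n) ⟩
    ι 2 · (1ᵢ + (ι m + ι n))                         ≡⟨ cong (λ x → ι 2 · (1ᵢ + x)) (ι-homo-+ m n) ⟨
    ι 2 · ι (suc (m ℕ.+ n))                          ∎
    where
    open ≡-Reasoning
    identity : ∀ u v → (1ᵢ + ι 2 · u) + (1ᵢ + ι 2 · v) ≡ ι 2 · (1ᵢ + (u + v))
    identity = solve 2 (λ u v →
      Κ 1ᵢ :+ Κ (ι 2) :* u :+ (Κ 1ᵢ :+ Κ (ι 2) :* v)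
      ⊜ Κ (ι 2) :* (Κ 1ᵢ :+ (u :+ v))) refl

recurrence : ∀ a b X Y g → b · X ≡ a · Y → X + Y ≡ ι 4 · g → (a + b) · X ≡ ι 4 · a · g
recurrence a b X Y g bX≡aY X+Y≡4g = begin
  (a + b) · X      ≡⟨ distribute a b X ⟩
  a · X + b · X    ≡⟨ cong (λ t → a · X + t) bX≡aY ⟩
  a · X + a · Y    ≡⟨ factor a X Y ⟨
  a · (X + Y)      ≡⟨ cong (a ·_) X+Y≡4g ⟩
  a · (ι 4 · g)    ≡⟨ commute a (ι 4) g ⟩
  ι 4 · a · g      ∎
  where
  open ≡-Reasoning
  distribute : ∀ a b x → (a + b) · x ≡ a · x + b · x
  distribute = solve 3 (λ a b x → (a :+ b) :* x ⊜ (a :* x :+ b :* x)) refl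
  factor : ∀ a x y → a · (x + y) ≡ a · x + a · y
  factor = solve 3 (λ a x y → a :* (x :+ y) ⊜ (a :* x :+ a :* y)) refl
  commute : ∀ a b x → a · (b · x) ≡ b · a · x
  commute = solve 3 (λ a b x → a :* (b :* x) ⊜ b :* a :* x) refl

closed-form-step : ∀ g g′ d d′ N N′ k j r →
                   g · d ≡ ι 2 · N → (ι 2 · k) · g′ ≡ ι 4 · j · g →
                   d′ ≡ r · k · d → N′ ≡ ι 2 · r · j · N → g′ · d′ ≡ ι 2 · N′
closed-form-step g g′ d d′ N N′ k j r gd≡2N 2kg′≡4jg d′≡rkd N′≡2rjN = begin
  g′ · d′                     ≡⟨ cong (g′ ·_) d′≡rkd ⟩
  g′ · (r · k · d)            ≡⟨ regroup g′ r k d ⟩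
  r · d · (k · g′)            ≡⟨ cong (r · d ·_) kg′≡2jg ⟩
  r · d · (ι 2 · j · g)       ≡⟨ regroup′ r d j g ⟩
  ι 2 · r · j · (g · d)       ≡⟨ cong (ι 2 · r · j ·_) gd≡2N ⟩
  ι 2 · r · j · (ι 2 · N)     ≡⟨ regroup″ r j N ⟩
  ι 2 · (ι 2 · r · j · N)     ≡⟨ cong (ι 2 ·_) N′≡2rjN ⟨
  ι 2 · N′                    ∎
  where
  open ≡-Reasoning
  regroup : ∀ g r k d → g · (r · k · d) ≡ r · d · (k · g)
  regroup = solve 4 (λ g r k d → g :* (r :* k :* d) ⊜ r :* d :* (k :* g)) refl
  regroup′ : ∀ r d j g → r · d · (ι 2 · j · g) ≡ ι 2 · r · j · (g · d)
  regroup′ = solve 4 (λ r d j g →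
    r :* d :* (Κ (ι 2) :* j :* g)
    ⊜ Κ (ι 2) :* r :* j :* (g :* d)) refl
  regroup″ : ∀ r j N → ι 2 · r · j · (ι 2 · N) ≡ ι 2 · (ι 2 · r · j · N)
  regroup″ = solve 3 (λ r j N →
    Κ (ι 2) :* r :* j :* (Κ (ι 2) :* N)
    ⊜ Κ (ι 2) :* (Κ (ι 2) :* r :* j :* N)) refl
  halve : ∀ k g′ j g → ι 2 · k · g′ ≡ ι 4 · j · g → ι 2 · (k · g′) ≡ ι 2 · (ι 2 · j · g)
  halve k g′ j g eq = trans (sym (reassoc (ι 2) k g′)) (trans eq (twice j g))
    where
    reassoc : ∀ a b c → a · b · c ≡ a · (b · c)
    reassoc = solve 3 (λ a b c → a :* b :* c ⊜ a :* (b :* c)) refl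
    twice : ∀ j g → ι 4 · j · g ≡ ι 2 · (ι 2 · j · g)
    twice = solve 2 (λ j g → Κ (ι 4) :* j :* g ⊜ Κ (ι 2) :* (Κ (ι 2) :* j :* g)) refl
  kg′≡2jg : k · g′ ≡ ι 2 · j · g
  kg′≡2jg = ·-cancelˡ (ι-suc≢0 1) (halve k g′ j g 2kg′≡4jg)

module ClosedForm (G : Table) (G-circular : Circular G)
                  (G-balance : ∀ m n → ι (suc n) · G (2 ℕ.+ m) n ≡ ι (suc m) · G m (2 ℕ.+ n)) where

  ClosedFormAt : ℕ → ℕ → Set
  ClosedFormAt m n = G (2 ℕ.* m) (2 ℕ.* n) · ι (denominator m n) ≡ ι 2 · ι (numerator m n)

  private
    step₁ : ∀ m n → ClosedFormAt m n → ClosedFormAt (suc m) n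
    step₁ m n claim =
      closed-form-step g g′ (ι (denominator m n)) (ι (denominator (suc m) n))
                       (ι (numerator m n)) (ι (numerator (suc m) n)) k j r
                       claim 2kg′≡4jg d′≡rkd N′≡2rjN
      where
      open ≡-Reasoning
      g  = G (2 ℕ.* m) (2 ℕ.* n)
      g′ = G (2 ℕ.* suc m) (2 ℕ.* n)
      k = ι (suc (m ℕ.+ n))
      j = ι (suc (2 ℕ.* m))
      r = ι (suc m)
      2kg′≡4jg : (ι 2 · k) · g′ ≡ ι 4 · j · g
      2kg′≡4jg = begin
        (ι 2 · k) · g′
          ≡⟨ cong₂ _·_ (ι-odd+odd m n) (cong (λ a → G a (2 ℕ.* n)) (sym (2*suc m))) ⟨
        (ι (suc (2 ℕ.* m)) + ι (suc (2 ℕ.* n))) · G (2 ℕ.+ 2 ℕ.* m) (2 ℕ.* n)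
          ≡⟨ recurrence j (ι (suc (2 ℕ.* n))) _ _ g (G-balance (2 ℕ.* m) (2 ℕ.* n)) (G-circular (2 ℕ.* m) (2 ℕ.* n)) ⟩
        ι 4 · j · g ∎
      d′≡rkd : ι (denominator (suc m) n) ≡ r · k · ι (denominator m n)
      d′≡rkd = trans (cong ι (denominator-suc₁ m n)) (ι-homo-*₃ (suc m) (suc (m ℕ.+ n)) (denominator m n))
      N′≡2rjN : ι (numerator (suc m) n) ≡ ι 2 · r · j · ι (numerator m n)
      N′≡2rjN = trans (cong ι (numerator-suc₁ m n))
                      (trans (ι-homo-*₃ (suc (suc (2 ℕ.* m))) (suc (2 ℕ.* m)) (numerator m n))
                             (cong (λ x → x · j · ι (numerator m n)) (ι-2+2m m)))

    step₂ : ∀ m n → ClosedFormAt m n → ClosedFormAt m (suc n)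
    step₂ m n claim =
      closed-form-step g g′ (ι (denominator m n)) (ι (denominator m (suc n)))
                       (ι (numerator m n)) (ι (numerator m (suc n))) k j r
                       claim 2kg′≡4jg d′≡rkd N′≡2rjN
      where
      open ≡-Reasoning
      g  = G (2 ℕ.* m) (2 ℕ.* n)
      g′ = G (2 ℕ.* m) (2 ℕ.* suc n)
      k = ι (suc (m ℕ.+ n))
      j = ι (suc (2 ℕ.* n))
      r = ι (suc n)
      X = G (2 ℕ.+ 2 ℕ.* m) (2 ℕ.* n)
      Y = G (2 ℕ.* m) (2 ℕ.+ 2 ℕ.* n)
      2kg′≡4jg : (ι 2 · k) · g′ ≡ ι 4 · j · g
      2kg′≡4jg = begin
        (ι 2 · k) · g′
          ≡⟨ cong₂ _·_ (trans (+-comm j (ι (suc (2 ℕ.* m)))) (ι-odd+odd m n)) (cong (G (2 ℕ.* m)) (sym (2*suc n))) ⟨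
        (j + ι (suc (2 ℕ.* m))) · Y
          ≡⟨ recurrence j (ι (suc (2 ℕ.* m))) Y X g (sym (G-balance (2 ℕ.* m) (2 ℕ.* n)))
                        (trans (+-comm Y X) (G-circular (2 ℕ.* m) (2 ℕ.* n))) ⟩
        ι 4 · j · g ∎
      d′≡rkd : ι (denominator m (suc n)) ≡ r · k · ι (denominator m n)
      d′≡rkd = trans (cong ι (denominator-suc₂ m n)) (ι-homo-*₃ (suc n) (suc (m ℕ.+ n)) (denominator m n))
      N′≡2rjN : ι (numerator m (suc n)) ≡ ι 2 · r · j · ι (numerator m n)
      N′≡2rjN = trans (cong ι (numerator-suc₂ m n))
                      (trans (ι-homo-*₃ (suc (suc (2 ℕ.* n))) (suc (2 ℕ.* n)) (numerator m n))
                             (cong (λ x → x · j · ι (numerator m n)) (ι-2+2m n)))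

  closed-form : G 0 0 ≡ ι 2 → ∀ m n → ClosedFormAt m n
  closed-form G₀₀≡2 zero    zero    = cong (_· ι 1) G₀₀≡2
  closed-form G₀₀≡2 zero    (suc n) = step₂ zero n (closed-form G₀₀≡2 zero n)
  closed-form G₀₀≡2 (suc m) n       = step₁ m n (closed-form G₀₀≡2 m n)

module EvenMoments (φ : Poly → ℚ) (φ-circular : CircularIntegralFunctional φ) where
  open CircularIntegralFunctional φ-circular using (normalization)
  open Moments φ φ-circular
  open Family moments

  rotation-invariant : transform (rotation (+ 3 / 5) (+ 4 / 5)) moments ≗₂ moments
  rotation-invariant = moments-invariant (rotation (+ 3 / 5) (+ 4 / 5)) (record
    { tl₁₁ = refl ; tl₁₂ = refl ; tl₂₁ = refl ; tl₂₂ = refl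
    ; tr₁₁ = refl ; tr₁₂ = refl ; tr₂₁ = refl ; tr₂₂ = refl ; det = refl })

  open ClosedForm moments moments-circular (balance moments-circular rotation-invariant)

  even-moments : ∀ m n → moments (2 ℕ.* m) (2 ℕ.* n) ≡ ↑ ((+ 2 / 1) * S m n)
  even-moments m n = ·-cancelʳ (ι≢0 D) (begin
    moments (2 ℕ.* m) (2 ℕ.* n) · ι D     ≡⟨ closed-form (cong ↑_ normalization) m n ⟩
    ι 2 · ι (numerator m n)               ≡⟨ cong (ι 2 ·_) (↑n/d·ι≡ι (numerator m n) D) ⟨
    ι 2 · (↑ S m n · ι D)                 ≡⟨ ·-assoc (ι 2) (↑ S m n) (ι D) ⟨
    ι 2 · ↑ S m n · ι D                   ≡⟨ cong (_· ι D) (↑-homo-* (+ 2 / 1) (S m n)) ⟨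
    ↑ ((+ 2 / 1) * S m n) · ι D           ∎)
    where
    open ≡-Reasoning
    D = denominator m n
    instance _ = denominator≢0 m n

theorem15 : (φ : Poly → ℚ) → CircularIntegralFunctional φ →
    ∀ (m n : ℕ) → φ (mono (2 Data.Nat.* m) (2 Data.Nat.* n)) ≡ (+ 2 / 1) * S m n
theorem15 φ φ-circular m n = cong proj₁ (EvenMoments.even-moments φ φ-circular m n)
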